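{- Let $c=1/\sqrt{2}$, $d=2(\sqrt{2}-1)$, $a(n)=\lfloor cn+d\rfloor$ for $n\in\mathbb{Z}$, $f(n)=a(n)+a(n-1)$, $\theta_n=\{cn+d\}$, $\delta(n)=a(f(n))-n$, and $\mathcal{D}=\{n\ge 1:\ \delta(n)=1\}$. Then for every integer $n\ge 2$, \[ \delta(n)=1\iff \theta_{n-1}\in[1-c,\,1/2]. \] Consequently: (a) every $n\in\mathcal{D}$ satisfies $a(n+1)=a(n)$; (b) $\mathcal{D}$ has natural density $c-\tfrac12=\frac{\sqrt{2}-1}{2}$.
   Context: $\{x\}=x-\lfloor x\rfloor$ denotes the fractional part. The natural density of $A\subseteq\mathbb{Z}_{\ge1}$ is $\lim_{N\to\infty}\#(A\cap[1,N])/N$. -}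

module Defs where

open import Data.Nat as ℕ using (ℕ; zero; suc)
open import Data.Integer using (ℤ; +_; _+_; _-_; -_; _*_; _<_; _≤_; _≟_)
open import Data.Product using (_×_)
open import Data.Sum using (_⊎_)
open import Relation.Nullary using (¬_)
open import Relation.Nullary.Decidable using (⌊_⌋)
open import Data.Bool using (if_then_else_)

-- Exact comparisons between an integer y and √2·x (x, y ∈ ℤ), with no reals.
-- √2·x < y  holds iff  (y > 0 and (x ≤ 0 or 2x² < y²))  or  (y ≤ 0 and x < 0 and y² < 2x²).
√2*_<_ : ℤ → ℤ → Set
√2* x < y = ((+ 0 < y) × ((x ≤ + 0) ⊎ (+ 2 * (x * x) < y * y)))
          ⊎ ((y ≤ + 0) × ((x < + 0) × (y * y < + 2 * (x * x))))

_<√2*_ : ℤ → ℤ → Set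
y <√2* x = √2* (- x) < (- y)

√2*_≤_ : ℤ → ℤ → Set
√2* x ≤ y = ¬ (y <√2* x)

_≤√2*_ : ℤ → ℤ → Set
y ≤√2* x = ¬ (√2* x < y)

-- With c = 1/√2, d = 2(√2 - 1):  c n + d = √2 (n + 4) / 2 - 2.
-- a is the floor function n ↦ ⌊c n + d⌋ iff  a n ≤ c n + d < a n + 1, i.e.
--   2 (a n + 2) ≤ √2 (n + 4) < 2 (a n + 3).
IsFloorCnD : (ℤ → ℤ) → Set
IsFloorCnD a = ∀ n → ((+ 2 * (a n + + 2)) ≤√2* (n + + 4))
                   × (√2* (n + + 4) < (+ 2 * (a n + + 3)))

f : (ℤ → ℤ) → ℤ → ℤ
f a n = a n + a (n - + 1)

δ : (ℤ → ℤ) → ℤ → ℤ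
δ a n = a (f a n) - n

-- θ_m = {c m + d} ∈ [1 - c, 1/2], unfolded (with A = a m = ⌊c m + d⌋):
--   θ_m ≥ 1 - c  ⟺  c (m+1) + d ≥ A + 1  ⟺  2 (A + 3) ≤ √2 (m + 5)
--   θ_m ≤ 1/2    ⟺  c m + d ≤ A + 1/2    ⟺  √2 (m + 4) ≤ 2 A + 5
θ∈[1-c,1/2] : (ℤ → ℤ) → ℤ → Set
θ∈[1-c,1/2] a m = ((+ 2 * (a m + + 3)) ≤√2* (m + + 5))
                × (√2* (m + + 4) ≤ (+ 2 * a m + + 5))

countD : (ℤ → ℤ) → ℕ → ℕ
countD a zero = zero
countD a (suc N) = countD a N ℕ.+ (if ⌊ δ a (+ suc N) ≟ + 1 ⌋ then 1 else 0)

-- |countD N / N - (√2 - 1)/2| < 1/K  (for N ≥ 1, K ≥ 1), multiplied out by 2NK: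
--   2CK + NK - 2N < √2 NK   and   √2 NK < 2CK + NK + 2N
DensityClose : (ℤ → ℤ) → ℕ → ℕ → Set
DensityClose a K N =
  ((+ 2 * C * k + n * k - + 2 * n) <√2* (n * k))
  × (√2* (n * k) < (+ 2 * C * k + n * k + + 2 * n))
  where
    C = + countD a N
    n = + N
    k = + K

module Submission where

-- Work in ℤ[√2], ordered by the sign of u + v√2 (decided through ⌈v√2⌉), and with doubled
-- quantities: ξ n = √2 (n + 4) = 2 (c n + d + 2), so that a n + 2 = ⌊ξ n / 2⌋ and
-- ξ (n + 1) = ξ n + √2.  Put x = ξ (n - 1) and B = a (n - 1) + 2.  Then a n + 2 is B or B + 1,
-- and θ_{n-1} ∈ [1 - c, 1/2] says 2B + 2 ≤ x + √2 and x ≤ 2B + 1 (the Window).  Multiplying by √2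
-- turns x into the integer 2 (n + 3), so δ n = 1, i.e. ⌊√2 (a n + a (n - 1) + 4) / 2⌋ = n + 3, is
-- exactly the Window; inside the Window x + 2√2 < 2B + 4, whence a (n + 1) = a n.
-- For the density take (2P + 1)² - 2q² = ∓1, so that c q - P is just above (below) 1/2.  Then
-- ⌊(x + √2 q) / 2⌋ - B - P detects θ_{n-1} > 1/2, which bounds 𝟙𝒟 n below (above) by the increment
-- of Φ y = a y - Σ_{i<q} a (y + i) + P y.  Summing, the count up to N is Φ N - Φ 1 + O(1), and
-- 2 (Φ N - Φ 1) = N (2P + (1 - q) √2) + O(q), where 2P + (1 - q) √2 is within 1/K of √2 - 1.

open import Data.Integer using (ℤ)
open import Defs

module Sqrt2Floor where

  open import Data.Nat
  open import Data.Nat.Properties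
  open import Data.Nat.Divisibility using (_∣_; divides)
  open import Data.Nat.Induction using (<-rec)
  open import Data.Nat.Primality using (euclidsLemma; prime[2])
  open import Data.Sum using (reduce)
  open import Data.Empty using (⊥; ⊥-elim)
  open import Relation.Nullary using (yes; no)
  open import Relation.Binary.PropositionalEquality
  open import Data.Nat.Tactic.RingSolver using (solve-∀)

  m*m<n*n⇒m<n : ∀ {m n} → m * m < n * n → m < n
  m*m<n*n⇒m<n p = ≰⇒> λ n≤m → <⇒≱ p (*-mono-≤ n≤m n≤m)

  m*m≤n*n⇒m≤n : ∀ {m n} → m * m ≤ n * n → m ≤ n
  m*m≤n*n⇒m≤n p = ≮⇒≥ λ n<m → <⇒≱ (*-mono-< n<m n<m) p

  record IntegerSqrt (n : ℕ) : Set where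
    constructor isqrt
    field
      root : ℕ
      root*root≤n : root * root ≤ n
      n<suc[root]*suc[root] : n < suc root * suc root

  integerSqrt : ∀ n → IntegerSqrt n
  integerSqrt zero = isqrt 0 z≤n (s≤s z≤n)
  integerSqrt (suc n) with integerSqrt n
  ... | isqrt r lo hi with suc r * suc r ≤? suc n
  ...   | yes p = isqrt (suc r) p (≤-<-trans hi (*-mono-< (n<1+n (suc r)) (n<1+n (suc r))))
  ...   | no ¬p = isqrt r (≤-trans lo (n≤1+n n)) (≰⇒> ¬p)

  -- Abstract, so that unification never unfolds ⌊√2* k ⌋ and k stays inferable.
  abstract
    ⌊√2*_⌋ : ℕ → ℕ
    ⌊√2* k ⌋ = IntegerSqrt.root (integerSqrt (2 * (k * k)))

    ⌊√2*⌋-lower : ∀ k → ⌊√2* k ⌋ * ⌊√2* k ⌋ ≤ 2 * (k * k)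
    ⌊√2*⌋-lower k = IntegerSqrt.root*root≤n (integerSqrt (2 * (k * k)))

    ⌊√2*⌋-upper : ∀ k → 2 * (k * k) < suc ⌊√2* k ⌋ * suc ⌊√2* k ⌋
    ⌊√2*⌋-upper k = IntegerSqrt.n<suc[root]*suc[root] (integerSqrt (2 * (k * k)))

  ≤⌊√2*⌋ : ∀ {m k} → m * m ≤ 2 * (k * k) → m ≤ ⌊√2* k ⌋
  ≤⌊√2*⌋ {m} {k} p = s≤s⁻¹ (m*m<n*n⇒m<n (≤-<-trans p (⌊√2*⌋-upper k)))

  ⌊√2*⌋< : ∀ {m k} → 2 * (k * k) < m * m → ⌊√2* k ⌋ < m
  ⌊√2*⌋< {m} {k} p = m*m<n*n⇒m<n (≤-<-trans (⌊√2*⌋-lower k) p)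

  m*m≡2*k*k⇒k≡0 : ∀ k m → m * m ≡ 2 * (k * k) → k ≡ 0
  m*m≡2*k*k⇒k≡0 = <-rec _ descent
    where
    descent : ∀ k → (∀ {j} → j < k → ∀ m → m * m ≡ 2 * (j * j) → j ≡ 0) →
              ∀ m → m * m ≡ 2 * (k * k) → k ≡ 0
    descent zero _ _ _ = refl
    descent (suc k) rec m e = ⊥-elim (no-smaller j k²≡2j²)
      where
      2∣m : 2 ∣ m
      2∣m = reduce (euclidsLemma m m prime[2] (divides (suc k * suc k) (trans e (*-comm 2 _))))
      j : ℕ
      j = _∣_.quotient 2∣m
      regroup : ∀ j → 2 * (2 * (j * j)) ≡ (j * 2) * (j * 2)
      regroup = solve-∀
      k²≡2j² : suc k * suc k ≡ 2 * (j * j)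
      k²≡2j² = sym (*-cancelˡ-≡ _ _ 2
        (trans (regroup j) (trans (cong (λ x → x * x) (sym (_∣_.equality 2∣m))) e)))
      no-smaller : ∀ j → suc k * suc k ≡ 2 * (j * j) → ⊥
      no-smaller zero ()
      no-smaller j@(suc _) e′ = 1+n≢0 (rec j<1+k (suc k) e′)
        where
        j<1+k : j < suc k
        j<1+k = m*m<n*n⇒m<n (subst (j * j <_) (sym e′) (m<m+n (j * j) {j * j + 0} (s≤s z≤n)))

  private
    square-of-* : ∀ x y → (x * y) * (x * y) ≡ (x * x) * (y * y)
    square-of-* = solve-∀
    square-of-d* : ∀ d s t → (d * (s * s)) * (d * (t * t)) ≡ (d * (s * t)) * (d * (s * t))
    square-of-d* = solve-∀
    square-of-+ : ∀ x y → (x + y) * (x + y) ≡ x * x + 2 * (x * y) + y * y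
    square-of-+ = solve-∀
    d*square-of-+ : ∀ d s t → d * ((s + t) * (s + t)) ≡ d * (s * s) + 2 * (d * (s * t)) + d * (t * t)
    d*square-of-+ = solve-∀

  -- x * x ≤ d * (s * s) encodes x ≤ √d · s.
  module _ (d : ℕ) where

    *-mono-≤√ : ∀ {x y s t} → x * x ≤ d * (s * s) → y * y ≤ d * (t * t) → x * y ≤ d * (s * t)
    *-mono-≤√ {x} {y} {s} {t} x≤ y≤ = m*m≤n*n⇒m≤n (begin
      (x * y) * (x * y)                 ≡⟨ square-of-* x y ⟩
      (x * x) * (y * y)                 ≤⟨ *-mono-≤ x≤ y≤ ⟩
      (d * (s * s)) * (d * (t * t))     ≡⟨ square-of-d* d s t ⟩
      (d * (s * t)) * (d * (s * t))     ∎)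
      where open ≤-Reasoning

    *-mono-≥√ : ∀ {x y s t} → d * (s * s) ≤ x * x → d * (t * t) ≤ y * y → d * (s * t) ≤ x * y
    *-mono-≥√ {x} {y} {s} {t} ≤x ≤y = m*m≤n*n⇒m≤n (begin
      (d * (s * t)) * (d * (s * t))     ≡⟨ square-of-d* d s t ⟨
      (d * (s * s)) * (d * (t * t))     ≤⟨ *-mono-≤ ≤x ≤y ⟩
      (x * x) * (y * y)                 ≡⟨ square-of-* x y ⟨
      (x * y) * (x * y)                 ∎)
      where open ≤-Reasoning

    +-mono-≤√ : ∀ {x y s t} → x * x ≤ d * (s * s) → y * y ≤ d * (t * t) →
                (x + y) * (x + y) ≤ d * ((s + t) * (s + t))
    +-mono-≤√ {x} {y} {s} {t} x≤ y≤ = begin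
      (x + y) * (x + y)                                ≡⟨ square-of-+ x y ⟩
      x * x + 2 * (x * y) + y * y                      ≤⟨ +-mono-≤ (+-mono-≤ x≤ (*-monoʳ-≤ 2 xy≤)) y≤ ⟩
      d * (s * s) + 2 * (d * (s * t)) + d * (t * t)    ≡⟨ d*square-of-+ d s t ⟨
      d * ((s + t) * (s + t))                          ∎
      where
      open ≤-Reasoning
      xy≤ : x * y ≤ d * (s * t)
      xy≤ = *-mono-≤√ {x} {y} {s} {t} x≤ y≤

    +-mono->√ : ∀ {x y s t} → d * (s * s) < x * x → d * (t * t) < y * y →
                d * ((s + t) * (s + t)) < (x + y) * (x + y)
    +-mono->√ {x} {y} {s} {t} <x <y = begin-strict
      d * ((s + t) * (s + t))                          ≡⟨ d*square-of-+ d s t ⟩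
      d * (s * s) + 2 * (d * (s * t)) + d * (t * t)
        <⟨ +-mono-<-≤ (+-mono-<-≤ <x (*-monoʳ-≤ 2 ≤xy)) (<⇒≤ <y) ⟩
      x * x + 2 * (x * y) + y * y                      ≡⟨ square-of-+ x y ⟨
      (x + y) * (x + y)                                ∎
      where
      open ≤-Reasoning
      ≤xy : d * (s * t) ≤ x * y
      ≤xy = *-mono-≥√ {x} {y} {s} {t} (<⇒≤ <x) (<⇒≤ <y)

  ⌊√2*⌋-superadditive : ∀ s t → ⌊√2* s ⌋ + ⌊√2* t ⌋ ≤ ⌊√2* (s + t) ⌋
  ⌊√2*⌋-superadditive s t =
    ≤⌊√2*⌋ (+-mono-≤√ 2 {⌊√2* s ⌋} {⌊√2* t ⌋} {s} {t} (⌊√2*⌋-lower s) (⌊√2*⌋-lower t))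

  ⌊√2*[s+t]⌋≤1+⌊√2*s⌋+⌊√2*t⌋ : ∀ s t → ⌊√2* (s + t) ⌋ ≤ suc (⌊√2* s ⌋ + ⌊√2* t ⌋)
  ⌊√2*[s+t]⌋≤1+⌊√2*s⌋+⌊√2*t⌋ s t =
    s≤s⁻¹ (subst (⌊√2* (s + t) ⌋ <_) (+-suc (suc ⌊√2* s ⌋) ⌊√2* t ⌋)
    (⌊√2*⌋< (+-mono->√ 2 {suc ⌊√2* s ⌋} {suc ⌊√2* t ⌋} {s} {t}
                        (⌊√2*⌋-upper s) (⌊√2*⌋-upper t))))

module Sqrt2Ceiling where

  open import Data.Nat as ℕ using (ℕ; zero; suc)
  import Data.Nat.Properties as ℕ
  open import Data.Integer hiding (suc)
  open import Data.Integer.Properties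
  open import Relation.Nullary using (yes; no)
  open import Data.Product using (_,_)
  open import Relation.Binary.PropositionalEquality
  open import Data.Integer.Tactic.RingSolver using (solve-∀)
  open Sqrt2Floor

  ⌈√2*_⌉ : ℤ → ℤ
  ⌈√2* +0 ⌉ = + 0
  ⌈√2* +[1+ k ] ⌉ = + suc ⌊√2* suc k ⌋
  ⌈√2* -[1+ k ] ⌉ = - + ⌊√2* suc k ⌋

  ⌈√2*⌉-neg : ∀ k → ⌈√2* +[1+ k ] ⌉ + ⌈√2* -[1+ k ] ⌉ ≡ 1ℤ
  ⌈√2*⌉-neg k = trans (+-assoc 1ℤ s (- s)) (cong (_+_ 1ℤ) (+-inverseʳ s))
    where
    s : ℤ
    s = + ⌊√2* suc k ⌋

  private
    ≤-by-ℕ : ∀ {i j} m n → m ℕ.≤ n → j - i ≡ + n - + m → i ≤ j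
    ≤-by-ℕ m n m≤n eq = 0≤i-j⇒j≤i (subst (0ℤ ≤_) (sym eq) (i≤j⇒0≤j-i (+≤+ m≤n)))

    both-neg : ∀ a b c → c ℕ.≤ suc (a ℕ.+ b) → - + a + - + b ≤ - + c + 1ℤ
    both-neg a b c c≤ = ≤-by-ℕ c (suc (a ℕ.+ b)) c≤ (identity (+ a) (+ b) (+ c))
      where
      identity : ∀ a b c → - c + 1ℤ - (- a + - b) ≡ 1ℤ + (a + b) - c
      identity = solve-∀

    mixed-pos : ∀ a b c → a ℕ.≤ b ℕ.+ suc c → + suc a + - + b ≤ + suc c + 1ℤ
    mixed-pos a b c a≤ = ≤-by-ℕ a (b ℕ.+ suc c) a≤ (identity (+ a) (+ b) (+ c))
      where
      identity : ∀ a b c → 1ℤ + c + 1ℤ - (1ℤ + a + - b) ≡ b + (1ℤ + c) - a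
      identity = solve-∀

    mixed-neg : ∀ a b c → a ℕ.+ c ℕ.≤ b → + suc a + - + b ≤ - + c + 1ℤ
    mixed-neg a b c ≤b = ≤-by-ℕ (a ℕ.+ c) b ≤b (identity (+ a) (+ b) (+ c))
      where
      identity : ∀ a b c → - c + 1ℤ - (1ℤ + a + - b) ≡ b - (a + c)
      identity = solve-∀

    [m+n]⊖m≡n : ∀ m n → (m ℕ.+ n) ⊖ m ≡ + n
    [m+n]⊖m≡n zero n = refl
    [m+n]⊖m≡n (suc m) n = trans ([1+m]⊖[1+n]≡m⊖n (m ℕ.+ n) m) ([m+n]⊖m≡n m n)

    m⊖[1+m+n]≡-[1+n] : ∀ m n → m ⊖ suc (m ℕ.+ n) ≡ -[1+ n ]
    m⊖[1+m+n]≡-[1+n] zero n = refl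
    m⊖[1+m+n]≡-[1+n] (suc m) n = trans ([1+m]⊖[1+n]≡m⊖n m (suc (m ℕ.+ n))) (m⊖[1+m+n]≡-[1+n] m n)

    ⌈√2*⌉+1-resp : ∀ {i x y} → x ≡ y → i ≤ ⌈√2* y ⌉ + 1ℤ → i ≤ ⌈√2* x ⌉ + 1ℤ
    ⌈√2*⌉+1-resp refl i≤ = i≤

    ⌈√2*⌉-mixed : ∀ s t → ⌈√2* +[1+ s ] ⌉ + ⌈√2* -[1+ t ] ⌉ ≤ ⌈√2* (+[1+ s ] + -[1+ t ]) ⌉ + 1ℤ
    ⌈√2*⌉-mixed s t with suc t ℕ.≤? suc s
    ... | yes t≤s with ℕ.m≤n⇒∃[o]m+o≡n t≤s
    ...   | zero , refl rewrite ℕ.+-identityʳ t =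
      ⌈√2*⌉+1-resp (n⊖n≡0 (suc t)) (≤-reflexive (⌈√2*⌉-neg t))
    ...   | suc r , refl = ⌈√2*⌉+1-resp ([m+n]⊖m≡n (suc t) (suc r))
      (mixed-pos ⌊√2* suc t ℕ.+ suc r ⌋ ⌊√2* suc t ⌋ ⌊√2* suc r ⌋
        (subst (⌊√2* suc t ℕ.+ suc r ⌋ ℕ.≤_) (sym (ℕ.+-suc _ _))
               (⌊√2*[s+t]⌋≤1+⌊√2*s⌋+⌊√2*t⌋ (suc t) (suc r))))
    ⌈√2*⌉-mixed s t | no t≰s with ℕ.m≤n⇒∃[o]m+o≡n (ℕ.s≤s⁻¹ (ℕ.≰⇒> t≰s))
    ... | o , refl = ⌈√2*⌉+1-resp (m⊖[1+m+n]≡-[1+n] (suc s) o)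
      (mixed-neg ⌊√2* suc s ⌋ ⌊√2* suc (suc (s ℕ.+ o)) ⌋ ⌊√2* suc o ⌋
        (subst (λ n → ⌊√2* suc s ⌋ ℕ.+ ⌊√2* suc o ⌋ ℕ.≤ ⌊√2* n ⌋) (ℕ.+-suc (suc s) o)
               (⌊√2*⌋-superadditive (suc s) (suc o))))

  ⌈√2*v⌉+⌈√2*w⌉≤⌈√2*[v+w]⌉+1 : ∀ v w → ⌈√2* v ⌉ + ⌈√2* w ⌉ ≤ ⌈√2* (v + w) ⌉ + 1ℤ
  ⌈√2*v⌉+⌈√2*w⌉≤⌈√2*[v+w]⌉+1 +0 w
    rewrite +-identityˡ w | +-identityˡ ⌈√2* w ⌉ = i≤i+j ⌈√2* w ⌉ 1ℤ
  ⌈√2*v⌉+⌈√2*w⌉≤⌈√2*[v+w]⌉+1 v +0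
    rewrite +-identityʳ v | +-identityʳ ⌈√2* v ⌉ = i≤i+j ⌈√2* v ⌉ 1ℤ
  ⌈√2*v⌉+⌈√2*w⌉≤⌈√2*[v+w]⌉+1 +[1+ s ] +[1+ t ] = +≤+ (begin
    suc ⌊√2* suc s ⌋ ℕ.+ suc ⌊√2* suc t ⌋
      ≡⟨ cong suc (ℕ.+-suc ⌊√2* suc s ⌋ ⌊√2* suc t ⌋) ⟩
    suc (suc (⌊√2* suc s ⌋ ℕ.+ ⌊√2* suc t ⌋))
      ≤⟨ ℕ.s≤s (ℕ.s≤s (⌊√2*⌋-superadditive (suc s) (suc t))) ⟩
    suc (suc ⌊√2* suc s ℕ.+ suc t ⌋)
      ≡⟨ cong suc (ℕ.+-comm 1 _) ⟩
    suc ⌊√2* suc s ℕ.+ suc t ⌋ ℕ.+ 1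
      ∎)
    where open ℕ.≤-Reasoning
  ⌈√2*v⌉+⌈√2*w⌉≤⌈√2*[v+w]⌉+1 -[1+ s ] -[1+ t ] =
    both-neg ⌊√2* suc s ⌋ ⌊√2* suc t ⌋ ⌊√2* suc (suc (s ℕ.+ t)) ⌋
      (subst (λ n → ⌊√2* n ⌋ ℕ.≤ suc (⌊√2* suc s ⌋ ℕ.+ ⌊√2* suc t ⌋)) (ℕ.+-suc (suc s) t)
             (⌊√2*[s+t]⌋≤1+⌊√2*s⌋+⌊√2*t⌋ (suc s) (suc t)))
  ⌈√2*v⌉+⌈√2*w⌉≤⌈√2*[v+w]⌉+1 +[1+ s ] -[1+ t ] = ⌈√2*⌉-mixed s t
  ⌈√2*v⌉+⌈√2*w⌉≤⌈√2*[v+w]⌉+1 -[1+ t ] +[1+ s ]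
    rewrite +-comm ⌈√2* -[1+ t ] ⌉ ⌈√2* +[1+ s ] ⌉ | +-comm -[1+ t ] +[1+ s ] = ⌈√2*⌉-mixed s t

module ℤ[√2] where

  open import Data.Nat as ℕ using (ℕ; zero; suc)
  import Data.Nat.Properties as ℕ
  open import Data.Integer hiding (suc; Positive; positive; _⊖_)
  open import Data.Integer.Properties
  open import Data.Product using (_×_; _,_)
  open import Data.Sum using (_⊎_; inj₁; inj₂; map₂)
  open import Data.Empty using (⊥-elim)
  open import Relation.Nullary using (¬_; yes; no)
  open import Relation.Binary.PropositionalEquality
  open import Relation.Binary.Structures using (IsPreorder)
  open import Data.Integer.Tactic.RingSolver using (solve-∀)
  import Data.Nat.Tactic.RingSolver
  open Sqrt2Floor
  open Sqrt2Ceiling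

  -- u ⊹ v stands for u + v√2.
  infix 5 _⊹_
  record ℤ√2 : Set where
    constructor _⊹_
    field
      re im : ℤ
  open ℤ√2 public

  ι : ℤ → ℤ√2
  ι u = u ⊹ 0ℤ

  √2·_ : ℤ → ℤ√2
  √2· v = 0ℤ ⊹ v

  infixl 6 _⊕_ _⊖_
  _⊕_ _⊖_ : ℤ√2 → ℤ√2 → ℤ√2
  x ⊕ y = (re x + re y) ⊹ (im x + im y)
  x ⊖ y = (re x - re y) ⊹ (im x - im y)

  infixr 7 _·_
  _·_ : ℕ → ℤ√2 → ℤ√2
  k · x = (+ k * re x) ⊹ (+ k * im x)

  infix 8 √2⊛_
  √2⊛_ : ℤ√2 → ℤ√2
  √2⊛ x = (+ 2 * im x) ⊹ re x

  ⊹-cong : ∀ {u u′ v v′} → u ≡ u′ → v ≡ v′ → u ⊹ v ≡ u′ ⊹ v′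
  ⊹-cong = cong₂ _⊹_

  ⊕-identityʳ : ∀ x → x ⊕ ι 0ℤ ≡ x
  ⊕-identityʳ x = ⊹-cong (+-identityʳ (re x)) (+-identityʳ (im x))

  ·-suc : ∀ k x → suc k · x ≡ x ⊕ k · x
  ·-suc k x = ⊹-cong (suc-* (+ k) (re x)) (suc-* (+ k) (im x))

  -- u + v√2 > 0 iff u + ⌈v√2⌉ ≥ 1, because v√2 is irrational unless v = 0.
  record Positive (x : ℤ√2) : Set where
    constructor positive
    field
      1≤re+⌈√2*im⌉ : 1ℤ ≤ re x + ⌈√2* im x ⌉

  private
    positive-resp : ∀ {x y} → x ≡ y → Positive x → Positive y
    positive-resp refl p = p

  private
    +-cancelʳ-≤ : ∀ k {i j} → i + k ≤ j + k → i ≤ j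
    +-cancelʳ-≤ k {i} {j} p = subst₂ _≤_ (cancel i k) (cancel j k) (+-monoˡ-≤ (- k) p)
      where
      cancel : ∀ x k → x + k - k ≡ x
      cancel = solve-∀

  positive-⊕ : ∀ {x y} → Positive x → Positive y → Positive (x ⊕ y)
  positive-⊕ {u ⊹ v} {u′ ⊹ v′} (positive p) (positive q) = positive (+-cancelʳ-≤ 1ℤ (begin
    1ℤ + 1ℤ                                     ≤⟨ +-mono-≤ p q ⟩
    (u + ⌈√2* v ⌉) + (u′ + ⌈√2* v′ ⌉)           ≡⟨ regroup u u′ ⌈√2* v ⌉ ⌈√2* v′ ⌉ ⟩
    (u + u′) + (⌈√2* v ⌉ + ⌈√2* v′ ⌉)
      ≤⟨ +-monoʳ-≤ (u + u′) (⌈√2*v⌉+⌈√2*w⌉≤⌈√2*[v+w]⌉+1 v v′) ⟩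
    (u + u′) + (⌈√2* (v + v′) ⌉ + 1ℤ)           ≡⟨ +-assoc (u + u′) _ 1ℤ ⟨
    (u + u′) + ⌈√2* (v + v′) ⌉ + 1ℤ             ∎))
    where
    open ≤-Reasoning
    regroup : ∀ a b c d → (a + c) + (b + d) ≡ (a + b) + (c + d)
    regroup = solve-∀

  ¬positive-0 : ¬ Positive (0ℤ ⊹ 0ℤ)
  ¬positive-0 (positive (+≤+ ()))

  private
    positive-dichotomy : ∀ u v → ⌈√2* v ⌉ + ⌈√2* (- v) ⌉ ≡ 1ℤ →
                         Positive (u ⊹ v) ⊎ Positive (- u ⊹ - v)
    positive-dichotomy u v ⌈v⌉+⌈-v⌉≡1 with 1ℤ ≤? u + ⌈√2* v ⌉
    ... | yes p = inj₁ (positive p)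
    ... | no ¬p = inj₂ (positive (begin
      1ℤ                                           ≤⟨ +-monoʳ-≤ 1ℤ (neg-mono-≤ u+⌈v⌉≤0) ⟩
      1ℤ - (u + ⌈√2* v ⌉)                         ≡⟨ cong (_- (u + ⌈√2* v ⌉)) ⌈v⌉+⌈-v⌉≡1 ⟨
      (⌈√2* v ⌉ + ⌈√2* (- v) ⌉) - (u + ⌈√2* v ⌉)  ≡⟨ cancel u ⌈√2* v ⌉ ⌈√2* (- v) ⌉ ⟩
      - u + ⌈√2* (- v) ⌉                          ∎))
      where
      open ≤-Reasoning
      u+⌈v⌉≤0 : u + ⌈√2* v ⌉ ≤ 0ℤ
      u+⌈v⌉≤0 = i<j⇒i≤pred[j] (≰⇒> ¬p)
      cancel : ∀ u a b → (a + b) - (u + a) ≡ - u + b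
      cancel = solve-∀

  positive-trichotomy : ∀ u v → Positive (u ⊹ v) ⊎ Positive (- u ⊹ - v) ⊎ (u ≡ 0ℤ × v ≡ 0ℤ)
  positive-trichotomy +0 +0 = inj₂ (inj₂ (refl , refl))
  positive-trichotomy +[1+ n ] +0 = inj₁ (positive (+≤+ (ℕ.s≤s ℕ.z≤n)))
  positive-trichotomy -[1+ n ] +0 = inj₂ (inj₁ (positive (+≤+ (ℕ.s≤s ℕ.z≤n))))
  positive-trichotomy u +[1+ k ] = map₂ inj₁ (positive-dichotomy u +[1+ k ] (⌈√2*⌉-neg k))
  positive-trichotomy u -[1+ k ] =
    map₂ inj₁ (positive-dichotomy u -[1+ k ]
      (trans (+-comm ⌈√2* -[1+ k ] ⌉ ⌈√2* +[1+ k ] ⌉) (⌈√2*⌉-neg k)))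

  private
    positive-· : ∀ k {x} → Positive x → Positive (suc k · x)
    positive-· zero {x} = positive-resp (⊹-cong (sym (*-identityˡ (re x))) (sym (*-identityˡ (im x))))
    positive-· (suc k) {x} p = positive-resp (⊹-cong (sym (suc-* (+ suc k) (re x))) (sym (suc-* (+ suc k) (im x))))
      (positive-⊕ p (positive-· k p))

  private
    1≤a-b : ∀ {a b} → b ℕ.< a → 1ℤ ≤ + a - + b
    1≤a-b {a} {b} b<a = begin
      1ℤ                 ≡⟨ cancel (+ b) ⟨
      + b + 1ℤ - + b     ≤⟨ +-monoˡ-≤ (- + b) (+≤+ (subst (ℕ._≤ a) (ℕ.+-comm 1 b) b<a)) ⟩
      + a - + b          ∎
      where
      open ≤-Reasoning
      cancel : ∀ b → b + 1ℤ - b ≡ 1ℤ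
      cancel = solve-∀

    1≤i-b⇒1+b≤i : ∀ {i} b → 1ℤ ≤ i - + b → + suc b ≤ i
    1≤i-b⇒1+b≤i {i} b 1≤i-b = begin
      1ℤ + + b            ≤⟨ +-monoˡ-≤ (+ b) 1≤i-b ⟩
      i - + b + + b       ≡⟨ cancel i (+ b) ⟩
      i                   ∎
      where
      open ≤-Reasoning
      cancel : ∀ i b → i - b + b ≡ i
      cancel = solve-∀

  √2*<⇒positive : ∀ x y → √2* x < y → Positive (y ⊹ - x)
  √2*<⇒positive +0 y (inj₁ (0<y , _)) = positive (subst (1ℤ ≤_) (sym (+-identityʳ y)) (i<j⇒suc[i]≤j 0<y))
  √2*<⇒positive +0 y (inj₂ (_ , +<+ () , _))
  √2*<⇒positive +[1+ k ] y (inj₁ (_ , inj₁ (+≤+ ())))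
  √2*<⇒positive +[1+ k ] +0 (inj₁ (+<+ () , inj₂ _))
  √2*<⇒positive +[1+ k ] +[1+ m ] (inj₁ (_ , inj₂ (+<+ 2x²<y²))) = positive (1≤a-b (⌊√2*⌋< 2x²<y²))
  √2*<⇒positive +[1+ k ] y (inj₂ (_ , +<+ () , _))
  √2*<⇒positive -[1+ k ] y (inj₁ (0<y , _)) =
    positive (≤-trans (i<j⇒suc[i]≤j 0<y) (i≤i+j y (+ suc ⌊√2* suc k ⌋)))
  √2*<⇒positive -[1+ k ] +0 (inj₂ _) = positive (+≤+ (ℕ.s≤s ℕ.z≤n))
  √2*<⇒positive -[1+ k ] +[1+ m ] (inj₂ (+≤+ () , _))
  √2*<⇒positive -[1+ k ] -[1+ j ] (inj₂ (_ , _ , +<+ y²<2x²)) = positive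
    (≤-trans (1≤a-b (ℕ.s≤s (≤⌊√2*⌋ {suc j} {suc k} (ℕ.<⇒≤ y²<2x²))))
             (≤-reflexive (+-comm (+ suc ⌊√2* suc k ⌋) -[1+ j ])))

  positive⇒√2*< : ∀ x y → Positive (y ⊹ - x) → √2* x < y
  positive⇒√2*< +0 y (positive p) =
    inj₁ (suc[i]≤j⇒i<j (subst (1ℤ ≤_) (+-identityʳ y) p) , inj₁ (+≤+ ℕ.z≤n))
  positive⇒√2*< +[1+ k ] y (positive p) with 1≤i-b⇒1+b≤i {y} ⌊√2* suc k ⌋ p
  ... | +≤+ {n = suc m} 1+S≤m =
    inj₁ (+<+ (ℕ.s≤s ℕ.z≤n) ,
          inj₂ (+<+ (ℕ.<-≤-trans (⌊√2*⌋-upper (suc k)) (ℕ.*-mono-≤ 1+S≤m 1+S≤m))))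
  positive⇒√2*< -[1+ k ] +0 _ = inj₂ (+≤+ ℕ.z≤n , -<+ , +<+ (ℕ.s≤s ℕ.z≤n))
  positive⇒√2*< -[1+ k ] +[1+ m ] _ = inj₁ (+<+ (ℕ.s≤s ℕ.z≤n) , inj₁ -≤+)
  positive⇒√2*< -[1+ k ] -[1+ j ] (positive p) = inj₂ (-≤+ , -<+ , +<+ (ℕ.≤∧≢⇒< y²≤2x² y²≢2x²))
    where
    1+j≤S : suc j ℕ.≤ ⌊√2* suc k ⌋
    1+j≤S = ℕ.s≤s⁻¹ (drop‿+≤+ (1≤i-b⇒1+b≤i {+ suc ⌊√2* suc k ⌋} (suc j)
      (≤-trans p (≤-reflexive (+-comm -[1+ j ] (+ suc ⌊√2* suc k ⌋))))))
    y²≤2x² : suc j ℕ.* suc j ℕ.≤ 2 ℕ.* (suc k ℕ.* suc k)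
    y²≤2x² = ℕ.≤-trans (ℕ.*-mono-≤ 1+j≤S 1+j≤S) (⌊√2*⌋-lower (suc k))
    y²≢2x² : suc j ℕ.* suc j ≢ 2 ℕ.* (suc k ℕ.* suc k)
    y²≢2x² e = ℕ.1+n≢0 (m*m≡2*k*k⇒k≡0 (suc k) (suc j) e)

  private
    double-square : ∀ a → (2 ℕ.* a) ℕ.* (2 ℕ.* a) ≡ 2 ℕ.* (2 ℕ.* (a ℕ.* a))
    double-square = Data.Nat.Tactic.RingSolver.solve-∀

    √2*x<y⇒√2*[-y]<-2x : ∀ x y → √2* x < y → √2* (- y) < (+ 2 * (- x))
    √2*x<y⇒√2*[-y]<-2x +0 +[1+ m ] _ = inj₂ (+≤+ ℕ.z≤n , -<+ , +<+ (ℕ.s≤s ℕ.z≤n))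
    √2*x<y⇒√2*[-y]<-2x +0 +0 (inj₁ (+<+ () , _))
    √2*x<y⇒√2*[-y]<-2x +0 -[1+ m ] (inj₁ (() , _))
    √2*x<y⇒√2*[-y]<-2x +0 y (inj₂ (_ , +<+ () , _))
    √2*x<y⇒√2*[-y]<-2x +[1+ k ] y (inj₁ (_ , inj₁ (+≤+ ())))
    √2*x<y⇒√2*[-y]<-2x +[1+ k ] +0 (inj₁ (+<+ () , _))
    √2*x<y⇒√2*[-y]<-2x +[1+ k ] +[1+ m ] (inj₁ (_ , inj₂ (+<+ 2x²<y²))) =
      inj₂ (-≤+ , -<+ , +<+ (subst (ℕ._< 2 ℕ.* (suc m ℕ.* suc m)) (sym (double-square (suc k)))
                                   (ℕ.*-monoʳ-< 2 2x²<y²)))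
    √2*x<y⇒√2*[-y]<-2x +[1+ k ] y (inj₂ (_ , +<+ () , _))
    √2*x<y⇒√2*[-y]<-2x -[1+ k ] +[1+ m ] _ = inj₁ (+<+ (ℕ.s≤s ℕ.z≤n) , inj₁ -≤+)
    √2*x<y⇒√2*[-y]<-2x -[1+ k ] +0 _ = inj₁ (+<+ (ℕ.s≤s ℕ.z≤n) , inj₁ (+≤+ ℕ.z≤n))
    √2*x<y⇒√2*[-y]<-2x -[1+ k ] -[1+ j ] (inj₁ (() , _))
    √2*x<y⇒√2*[-y]<-2x -[1+ k ] -[1+ j ] (inj₂ (_ , _ , +<+ y²<2x²)) =
      inj₁ (+<+ (ℕ.s≤s ℕ.z≤n) ,
            inj₂ (+<+ (subst (2 ℕ.* (suc j ℕ.* suc j) ℕ.<_) (sym (double-square (suc k)))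
                             (ℕ.*-monoʳ-< 2 y²<2x²))))

  positive-√2⊛ : ∀ {x} → Positive x → Positive (√2⊛ x)
  positive-√2⊛ {u ⊹ v} p = positive-resp (⊹-cong (cong (+ 2 *_) (neg-involutive v)) (neg-involutive u))
    (√2*<⇒positive (- u) (+ 2 * - - v)
      (√2*x<y⇒√2*[-y]<-2x (- v) u
        (positive⇒√2*< (- v) u (positive-resp (⊹-cong refl (sym (neg-involutive v))) p))))

  infix 4 _≺_ _≼_
  record _≺_ (x y : ℤ√2) : Set where
    constructor mk≺
    field
      positive-difference : Positive (y ⊖ x)
  open _≺_ public

  _≼_ : ℤ√2 → ℤ√2 → Set
  x ≼ y = x ≺ y ⊎ x ≡ y

  ≺-trans : ∀ {x y z} → x ≺ y → y ≺ z → x ≺ z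
  ≺-trans {x} {y} {z} (mk≺ p) (mk≺ q) = mk≺ (positive-resp
    (⊹-cong (+-minus-telescope (re z) (re y) (re x)) (+-minus-telescope (im z) (im y) (im x)))
    (positive-⊕ q p))

  ≺-irrefl : ∀ {x} → ¬ x ≺ x
  ≺-irrefl {x} (mk≺ p) = ¬positive-0 (positive-resp (⊹-cong (+-inverseʳ (re x)) (+-inverseʳ (im x))) p)

  ≺-asym : ∀ {x y} → x ≺ y → ¬ y ≺ x
  ≺-asym p q = ≺-irrefl (≺-trans p q)

  ≺-trichotomy : ∀ x y → x ≺ y ⊎ y ≺ x ⊎ x ≡ y
  ≺-trichotomy x y with positive-trichotomy (re y - re x) (im y - im x)
  ... | inj₁ p = inj₁ (mk≺ p)
  ... | inj₂ (inj₁ p) = inj₂ (inj₁ (mk≺ (positive-resp (⊹-cong (flip (re x) (re y)) (flip (im x) (im y))) p)))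
    where
    flip : ∀ a b → - (b - a) ≡ a - b
    flip = solve-∀
  ... | inj₂ (inj₂ (e₁ , e₂)) = inj₂ (inj₂ (sym (⊹-cong (i-j≡0⇒i≡j _ _ e₁) (i-j≡0⇒i≡j _ _ e₂))))

  ≼-refl : ∀ {x} → x ≼ x
  ≼-refl = inj₂ refl

  ≺⇒≼ : ∀ {x y} → x ≺ y → x ≼ y
  ≺⇒≼ = inj₁

  ≼-≺-trans : ∀ {x y z} → x ≼ y → y ≺ z → x ≺ z
  ≼-≺-trans (inj₁ p) q = ≺-trans p q
  ≼-≺-trans (inj₂ refl) q = q

  ≺-≼-trans : ∀ {x y z} → x ≺ y → y ≼ z → x ≺ z
  ≺-≼-trans p (inj₁ q) = ≺-trans p q
  ≺-≼-trans p (inj₂ refl) = p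

  ≼-trans : ∀ {x y z} → x ≼ y → y ≼ z → x ≼ z
  ≼-trans p (inj₁ q) = inj₁ (≼-≺-trans p q)
  ≼-trans p (inj₂ refl) = p

  ≼⇒⊁ : ∀ {x y} → x ≼ y → ¬ y ≺ x
  ≼⇒⊁ (inj₁ p) = ≺-asym p
  ≼⇒⊁ (inj₂ refl) = ≺-irrefl

  ⊁⇒≼ : ∀ {x y} → ¬ y ≺ x → x ≼ y
  ⊁⇒≼ {x} {y} ¬y≺x with ≺-trichotomy x y
  ... | inj₁ p = inj₁ p
  ... | inj₂ (inj₁ q) = ⊥-elim (¬y≺x q)
  ... | inj₂ (inj₂ e) = inj₂ e

  ≺-≽-dec : ∀ x y → x ≺ y ⊎ y ≼ x
  ≺-≽-dec x y with ≺-trichotomy x y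
  ... | inj₁ p = inj₁ p
  ... | inj₂ (inj₁ q) = inj₂ (inj₁ q)
  ... | inj₂ (inj₂ e) = inj₂ (inj₂ (sym e))

  ≼-isPreorder : IsPreorder _≡_ _≼_
  ≼-isPreorder = record { isEquivalence = isEquivalence ; reflexive = inj₂ ; trans = ≼-trans }

  module ≼-Reasoning where
    open import Relation.Binary.Reasoning.Base.Triple
      ≼-isPreorder ≺-asym ≺-trans (resp₂ _≺_) ≺⇒≼ ≺-≼-trans ≼-≺-trans public
      hiding (step-≈; step-≈˘; step-≈-⟩; step-≈-⟨)

  private
    ⊕-⊖-interchange : ∀ x y z w → (y ⊕ w) ⊖ (x ⊕ z) ≡ (y ⊖ x) ⊕ (w ⊖ z)
    ⊕-⊖-interchange x y z w =
      ⊹-cong (interchange (re x) (re y) (re z) (re w)) (interchange (im x) (im y) (im z) (im w))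
      where
      interchange : ∀ a b c d → (b + d) - (a + c) ≡ (b - a) + (d - c)
      interchange = solve-∀

  ⊕-mono-≺ : ∀ {x y z w} → x ≺ y → z ≺ w → x ⊕ z ≺ y ⊕ w
  ⊕-mono-≺ {x} {y} {z} {w} (mk≺ p) (mk≺ q) =
    mk≺ (positive-resp (sym (⊕-⊖-interchange x y z w)) (positive-⊕ p q))

  ≺-by-difference : ∀ {x y x′ y′} → x ≺ y → y′ ⊖ x′ ≡ y ⊖ x → x′ ≺ y′
  ≺-by-difference (mk≺ p) e = mk≺ (positive-resp (sym e) p)

  ⊕-monoˡ-≺ : ∀ {x y} z → x ≺ y → x ⊕ z ≺ y ⊕ z
  ⊕-monoˡ-≺ {x} {y} z x≺y =
    ≺-by-difference x≺y (⊹-cong (cancel (re x) (re y) (re z)) (cancel (im x) (im y) (im z)))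
    where
    cancel : ∀ a b c → (b + c) - (a + c) ≡ b - a
    cancel = solve-∀

  ⊕-monoʳ-≺ : ∀ z {x y} → x ≺ y → z ⊕ x ≺ z ⊕ y
  ⊕-monoʳ-≺ z {x} {y} x≺y =
    ≺-by-difference x≺y (⊹-cong (cancel (re x) (re y) (re z)) (cancel (im x) (im y) (im z)))
    where
    cancel : ∀ a b c → (c + b) - (c + a) ≡ b - a
    cancel = solve-∀

  ⊕-mono-≼-≺ : ∀ {x y z w} → x ≼ y → z ≺ w → x ⊕ z ≺ y ⊕ w
  ⊕-mono-≼-≺ (inj₁ p) q = ⊕-mono-≺ p q
  ⊕-mono-≼-≺ {x} (inj₂ refl) q = ⊕-monoʳ-≺ x q

  ⊕-mono-≺-≼ : ∀ {x y z w} → x ≺ y → z ≼ w → x ⊕ z ≺ y ⊕ w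
  ⊕-mono-≺-≼ p (inj₁ q) = ⊕-mono-≺ p q
  ⊕-mono-≺-≼ {z = z} p (inj₂ refl) = ⊕-monoˡ-≺ z p

  ⊕-mono-≼ : ∀ {x y z w} → x ≼ y → z ≼ w → x ⊕ z ≼ y ⊕ w
  ⊕-mono-≼ p (inj₁ q) = inj₁ (⊕-mono-≼-≺ p q)
  ⊕-mono-≼ (inj₁ p) (inj₂ refl) = inj₁ (⊕-mono-≺-≼ p (inj₂ refl))
  ⊕-mono-≼ (inj₂ refl) (inj₂ refl) = inj₂ refl

  ·-mono-≺ : ∀ k {x y} → x ≺ y → suc k · x ≺ suc k · y
  ·-mono-≺ k {x} {y} (mk≺ p) = mk≺ (positive-resp
    (⊹-cong (distrib (+ suc k) (re x) (re y)) (distrib (+ suc k) (im x) (im y))) (positive-· k p))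
    where
    distrib : ∀ k a b → k * (b - a) ≡ k * b - k * a
    distrib = solve-∀

  ·-mono-≼ : ∀ k {x y} → x ≼ y → k · x ≼ k · y
  ·-mono-≼ zero _ = inj₂ refl
  ·-mono-≼ (suc k) (inj₁ p) = inj₁ (·-mono-≺ k p)
  ·-mono-≼ (suc k) (inj₂ refl) = inj₂ refl

  √2⊛-mono-≺ : ∀ {x y} → x ≺ y → √2⊛ x ≺ √2⊛ y
  √2⊛-mono-≺ {x} {y} (mk≺ p) = mk≺ (positive-resp (⊹-cong (distrib (im x) (im y)) refl) (positive-√2⊛ p))
    where
    distrib : ∀ a b → + 2 * (b - a) ≡ + 2 * b - + 2 * a
    distrib = solve-∀

  √2⊛-mono-≼ : ∀ {x y} → x ≼ y → √2⊛ x ≼ √2⊛ y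
  √2⊛-mono-≼ (inj₁ p) = inj₁ (√2⊛-mono-≺ p)
  √2⊛-mono-≼ (inj₂ refl) = inj₂ refl

  √2⊛-cancel-≼ : ∀ {x y} → √2⊛ x ≼ √2⊛ y → x ≼ y
  √2⊛-cancel-≼ p = ⊁⇒≼ (λ y≺x → ≼⇒⊁ p (√2⊛-mono-≺ y≺x))

  ι-mono-< : ∀ {a b} → a < b → ι a ≺ ι b
  ι-mono-< {a} {b} a<b = mk≺ (positive (begin
    1ℤ                     ≡⟨ cancel a ⟨
    1ℤ + a - a             ≤⟨ +-monoˡ-≤ (- a) (i<j⇒suc[i]≤j a<b) ⟩
    b - a                  ≡⟨ +-identityʳ (b - a) ⟨
    b - a + 0ℤ             ∎))
    where
    open ≤-Reasoning
    cancel : ∀ a → 1ℤ + a - a ≡ 1ℤ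
    cancel = solve-∀

  ι-cancel-< : ∀ {a b} → ι a ≺ ι b → a < b
  ι-cancel-< {a} {b} (mk≺ (positive p)) = suc[i]≤j⇒i<j (begin
    1ℤ + a                 ≤⟨ +-monoˡ-≤ a p ⟩
    b - a + 0ℤ + a         ≡⟨ cancel a b ⟩
    b                      ∎)
    where
    open ≤-Reasoning
    cancel : ∀ a b → b - a + 0ℤ + a ≡ b
    cancel = solve-∀

  ι-mono-≤ : ∀ {a b} → a ≤ b → ι a ≼ ι b
  ι-mono-≤ a≤b = ⊁⇒≼ (λ b≺a → <⇒≱ (ι-cancel-< b≺a) a≤b)

  ι≼√2·⇒ι≺√2· : ∀ {a v} → ι a ≼ √2· v → v ≢ 0ℤ → ι a ≺ √2· v
  ι≼√2·⇒ι≺√2· (inj₁ p) _ = p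
  ι≼√2·⇒ι≺√2· (inj₂ refl) v≢0 = ⊥-elim (v≢0 refl)

  √2*<⇒√2·≺ι : ∀ {v a} → √2* v < a → √2· v ≺ ι a
  √2*<⇒√2·≺ι {v} {a} p = mk≺ (positive-resp (⊹-cong (sym (+-identityʳ a)) (sym (+-identityˡ (- v))))
    (√2*<⇒positive v a p))

  √2·≺ι⇒√2*< : ∀ {v a} → √2· v ≺ ι a → √2* v < a
  √2·≺ι⇒√2*< {v} {a} (mk≺ p) =
    positive⇒√2*< v a (positive-resp (⊹-cong (+-identityʳ a) (+-identityˡ (- v))) p)

  <√2*⇒ι≺√2· : ∀ {v a} → a <√2* v → ι a ≺ √2· v
  <√2*⇒ι≺√2· {v} {a} p = mk≺ (positive-resp
    (⊹-cong (sym (+-identityˡ (- a))) (trans (neg-involutive v) (sym (+-identityʳ v))))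
    (√2*<⇒positive (- v) (- a) p))

  ι≺√2·⇒<√2* : ∀ {v a} → ι a ≺ √2· v → a <√2* v
  ι≺√2·⇒<√2* {v} {a} (mk≺ p) = positive⇒√2*< (- v) (- a) (positive-resp
    (⊹-cong (+-identityˡ (- a)) (trans (+-identityʳ v) (sym (neg-involutive v)))) p)

  ≤√2*⇒ι≼√2· : ∀ {v a} → a ≤√2* v → ι a ≼ √2· v
  ≤√2*⇒ι≼√2· a≤ = ⊁⇒≼ (λ q → a≤ (√2·≺ι⇒√2*< q))

  ι≼√2·⇒≤√2* : ∀ {v a} → ι a ≼ √2· v → a ≤√2* v
  ι≼√2·⇒≤√2* p q = ≼⇒⊁ p (√2*<⇒√2·≺ι q)

  √2*≤⇒√2·≼ι : ∀ {v a} → √2* v ≤ a → √2· v ≼ ι a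
  √2*≤⇒√2·≼ι ≤a = ⊁⇒≼ (λ q → ≤a (ι≺√2·⇒<√2* q))

  √2·≼ι⇒√2*≤ : ∀ {v a} → √2· v ≼ ι a → √2* v ≤ a
  √2·≼ι⇒√2*≤ p q = ≼⇒⊁ p (<√2*⇒ι≺√2· q)

  ι≺√2·-by-squares : ∀ {w z} → w ℕ.* w ℕ.< 2 ℕ.* (z ℕ.* z) → ι (+ w) ≺ √2· (+ z)
  ι≺√2·-by-squares {w} {zero} ()
  ι≺√2·-by-squares {zero} {suc z} _ =
    <√2*⇒ι≺√2· (inj₂ (+≤+ ℕ.z≤n , -<+ , +<+ (ℕ.s≤s ℕ.z≤n)))
  ι≺√2·-by-squares {suc w} {suc z} w²<2z² = <√2*⇒ι≺√2· (inj₂ (-≤+ , -<+ , +<+ w²<2z²))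

  √2·≺ι-by-squares : ∀ {z w} → 2 ℕ.* (z ℕ.* z) ℕ.< w ℕ.* w → √2· (+ z) ≺ ι (+ w)
  √2·≺ι-by-squares {z} {zero} ()
  √2·≺ι-by-squares {zero} {suc w} _ =
    √2*<⇒√2·≺ι (inj₁ (+<+ (ℕ.s≤s ℕ.z≤n) , inj₁ (+≤+ ℕ.z≤n)))
  √2·≺ι-by-squares {suc z} {suc w} 2z²<w² =
    √2*<⇒√2·≺ι (inj₁ (+<+ (ℕ.s≤s ℕ.z≤n) , inj₂ (+<+ 2z²<w²)))

  0≺√2 : ι 0ℤ ≺ √2· 1ℤ
  0≺√2 = ι≺√2·-by-squares (ℕ.s≤s ℕ.z≤n)

  0≺2 : ι 0ℤ ≺ ι (+ 2)
  0≺2 = ι-mono-< (+<+ (ℕ.s≤s ℕ.z≤n))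

  1≺√2 : ι 1ℤ ≺ √2· 1ℤ
  1≺√2 = ι≺√2·-by-squares (ℕ.s≤s (ℕ.s≤s ℕ.z≤n))

  √2≺2 : √2· 1ℤ ≺ ι (+ 2)
  √2≺2 = √2·≺ι-by-squares (ℕ.s≤s (ℕ.s≤s (ℕ.s≤s ℕ.z≤n)))

  2√2≺3 : √2· (+ 2) ≺ ι (+ 3)
  2√2≺3 = √2·≺ι-by-squares ℕ.≤-refl

module HalfFloors where

  open import Data.Integer hiding (suc; Positive; positive; _⊖_)
  open import Data.Integer.Properties
  open import Data.Nat using (s≤s; z≤n)
  open import Data.Sum using (_⊎_; inj₁; inj₂)
  open import Data.Product using (_×_; _,_)
  open import Function using (_∘_)
  open import Relation.Nullary using (¬_; yes; no)
  open import Data.Empty using (⊥-elim)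
  open import Relation.Binary.PropositionalEquality
  open import Data.Integer.Tactic.RingSolver using (solve-∀)
  open ℤ[√2]

  private
    1<2 : 1ℤ < + 2
    1<2 = +<+ (s≤s (s≤s z≤n))

    i<i+1 : ∀ i → i < i + 1ℤ
    i<i+1 i = suc[i]≤j⇒i<j (≤-reflexive (+-comm 1ℤ i))

    2i<2j+2⇒i≤j : ∀ {i j} → + 2 * i < + 2 * j + + 2 → i ≤ j
    2i<2j+2⇒i≤j {i} {j} 2i<2j+2 = ≮⇒≥ λ j<i → <⇒≱ 2i<2j+2 (begin
      + 2 * j + + 2      ≡⟨ distrib j ⟩
      + 2 * (1ℤ + j)     ≤⟨ *-monoˡ-≤-nonNeg (+ 2) (i<j⇒suc[i]≤j j<i) ⟩
      + 2 * i            ∎)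
      where
      open ≤-Reasoning
      distrib : ∀ j → + 2 * j + + 2 ≡ + 2 * (1ℤ + j)
      distrib = solve-∀

    i+1≤j⇒1≤j-i : ∀ {i j} → i + 1ℤ ≤ j → 1ℤ ≤ j - i
    i+1≤j⇒1≤j-i {i} {j} i+1≤j = begin
      1ℤ               ≡⟨ cancel i ⟨
      i + 1ℤ - i       ≤⟨ +-monoˡ-≤ (- i) i+1≤j ⟩
      j - i            ∎
      where
      open ≤-Reasoning
      cancel : ∀ i → i + 1ℤ - i ≡ 1ℤ
      cancel = solve-∀

    j≤i+1⇒j-i≤1 : ∀ {i j} → j ≤ i + 1ℤ → j - i ≤ 1ℤ
    j≤i+1⇒j-i≤1 {i} {j} j≤i+1 = begin
      j - i            ≤⟨ +-monoˡ-≤ (- i) j≤i+1 ⟩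
      i + 1ℤ - i       ≡⟨ cancel i ⟩
      1ℤ               ∎
      where
      open ≤-Reasoning
      cancel : ∀ i → i + 1ℤ - i ≡ 1ℤ
      cancel = solve-∀

  infix 4 ⌊_/2⌋≡_
  record ⌊_/2⌋≡_ (z : ℤ√2) (A : ℤ) : Set where
    field
      lower : ι (+ 2 * A) ≼ z
      upper : z ≺ ι (+ 2 * A + + 2)
  open ⌊_/2⌋≡_ public

  ⌊/2⌋-≥ : ∀ {z C k} → ⌊ z /2⌋≡ C → ι (+ 2 * k) ≼ z → k ≤ C
  ⌊/2⌋-≥ h 2k≼z = 2i<2j+2⇒i≤j (ι-cancel-< (≼-≺-trans 2k≼z (upper h)))

  ⌊/2⌋-≤ : ∀ {z C k} → ⌊ z /2⌋≡ C → z ≺ ι (+ 2 * k + + 2) → C ≤ k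
  ⌊/2⌋-≤ h z≺2k+2 = 2i<2j+2⇒i≤j (ι-cancel-< (≼-≺-trans (lower h) z≺2k+2))

  ⌊/2⌋-unique : ∀ {z A C} → ⌊ z /2⌋≡ A → ⌊ z /2⌋≡ C → A ≡ C
  ⌊/2⌋-unique hA hC = ≤-antisym (⌊/2⌋-≥ hC (lower hA)) (⌊/2⌋-≤ hC (upper hA))

  ⌊/2⌋-+-≥ : ∀ {x y A P C} → ⌊ x /2⌋≡ A → ι (+ 2 * P + 1ℤ) ≺ y →
             ⌊ x ⊕ y /2⌋≡ C → 0ℤ ≤ C - (A + P)
  ⌊/2⌋-+-≥ {x} {y} {A} {P} hA 2P+1≺y hC = i≤j⇒0≤j-i (⌊/2⌋-≥ hC (begin
    ι (+ 2 * (A + P))                  ≡⟨ cong ι (*-distribˡ-+ (+ 2) A P) ⟩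
    ι (+ 2 * A + + 2 * P)              <⟨ ι-mono-< (+-monoʳ-< (+ 2 * A) (i<i+1 (+ 2 * P))) ⟩
    ι (+ 2 * A) ⊕ ι (+ 2 * P + 1ℤ)     <⟨ ⊕-mono-≼-≺ (lower hA) 2P+1≺y ⟩
    x ⊕ y                              ∎))
    where open ≼-Reasoning

  ⌊/2⌋-+-≥-above-half : ∀ {x y A P C} → ι (+ 2 * A + 1ℤ) ≺ x → ι (+ 2 * P + 1ℤ) ≺ y →
                        ⌊ x ⊕ y /2⌋≡ C → 1ℤ ≤ C - (A + P)
  ⌊/2⌋-+-≥-above-half {x} {y} {A} {P} 2A+1≺x 2P+1≺y hC = i+1≤j⇒1≤j-i (⌊/2⌋-≥ hC (begin
    ι (+ 2 * (A + P + 1ℤ))                  ≡⟨ cong ι (regroup A P) ⟩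
    ι (+ 2 * A + 1ℤ) ⊕ ι (+ 2 * P + 1ℤ)     <⟨ ⊕-mono-≺ 2A+1≺x 2P+1≺y ⟩
    x ⊕ y                                   ∎))
    where
    open ≼-Reasoning
    regroup : ∀ A P → + 2 * (A + P + 1ℤ) ≡ (+ 2 * A + 1ℤ) + (+ 2 * P + 1ℤ)
    regroup = solve-∀

  ⌊/2⌋-+-≤ : ∀ {x y A P C} → ⌊ x /2⌋≡ A → y ≺ ι (+ 2 * P + 1ℤ) →
             ⌊ x ⊕ y /2⌋≡ C → C - (A + P) ≤ 1ℤ
  ⌊/2⌋-+-≤ {x} {y} {A} {P} hA y≺2P+1 hC = j≤i+1⇒j-i≤1 (⌊/2⌋-≤ hC (begin-strict
    x ⊕ y                                   <⟨ ⊕-mono-≺ (upper hA) y≺2P+1 ⟩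
    ι (+ 2 * A + + 2) ⊕ ι (+ 2 * P + 1ℤ)    ≡⟨ cong ι (regroup A P) ⟩
    ι (+ 2 * (A + P + 1ℤ) + 1ℤ)             <⟨ ι-mono-< (+-monoʳ-< (+ 2 * (A + P + 1ℤ)) 1<2) ⟩
    ι (+ 2 * (A + P + 1ℤ) + + 2)            ∎))
    where
    open ≼-Reasoning
    regroup : ∀ A P → (+ 2 * A + + 2) + (+ 2 * P + 1ℤ) ≡ + 2 * (A + P + 1ℤ) + 1ℤ
    regroup = solve-∀

  ⌊/2⌋-+-≤-below-half : ∀ {x y A P C} → x ≼ ι (+ 2 * A + 1ℤ) → y ≺ ι (+ 2 * P + 1ℤ) →
                        ⌊ x ⊕ y /2⌋≡ C → C - (A + P) ≤ 0ℤ
  ⌊/2⌋-+-≤-below-half {x} {y} {A} {P} x≼2A+1 y≺2P+1 hC = i≤j⇒i-j≤0 (⌊/2⌋-≤ hC (begin-strict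
    x ⊕ y                                   <⟨ ⊕-mono-≼-≺ x≼2A+1 y≺2P+1 ⟩
    ι (+ 2 * A + 1ℤ) ⊕ ι (+ 2 * P + 1ℤ)     ≡⟨ cong ι (regroup A P) ⟩
    ι (+ 2 * (A + P) + + 2)                 ∎))
    where
    open ≼-Reasoning
    regroup : ∀ A P → (+ 2 * A + 1ℤ) + (+ 2 * P + 1ℤ) ≡ + 2 * (A + P) + + 2
    regroup = solve-∀

  ⌊/2⌋-+-jump : ∀ {x y A C} → ⌊ x /2⌋≡ A → ι 0ℤ ≺ y → y ≺ ι (+ 2) → ⌊ x ⊕ y /2⌋≡ C →
                C ≡ A ⊎ C ≡ A + 1ℤ
  ⌊/2⌋-+-jump {x} {y} {A} {C} hA 0≺y y≺2 hC with C ≟ A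
  ... | yes C≡A = inj₁ C≡A
  ... | no C≢A = inj₂ (≤-antisym C≤A+1 (i<j⇒suc[i]≤j′ (≤∧≢⇒< A≤C (C≢A ∘ sym))))
    where
    open ≼-Reasoning
    A≤C : A ≤ C
    A≤C = ⌊/2⌋-≥ hC (begin
      ι (+ 2 * A)      ≤⟨ lower hA ⟩
      x                ≡⟨ ⊕-identityʳ x ⟨
      x ⊕ ι 0ℤ         <⟨ ⊕-monoʳ-≺ x 0≺y ⟩
      x ⊕ y            ∎)
    C≤A+1 : C ≤ A + 1ℤ
    C≤A+1 = ⌊/2⌋-≤ hC (begin-strict
      x ⊕ y                           <⟨ ⊕-mono-≺ (upper hA) y≺2 ⟩
      ι (+ 2 * A + + 2) ⊕ ι (+ 2)     ≡⟨ cong ι (regroup A) ⟩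
      ι (+ 2 * (A + 1ℤ) + + 2)        ∎)
      where
      regroup : ∀ A → + 2 * A + + 2 + + 2 ≡ + 2 * (A + 1ℤ) + + 2
      regroup = solve-∀
    i<j⇒suc[i]≤j′ : A < C → A + 1ℤ ≤ C
    i<j⇒suc[i]≤j′ A<C = subst (_≤ C) (+-comm 1ℤ A) (i<j⇒suc[i]≤j A<C)

  ⌊/2⌋-+-difference : ∀ {x y A C} → ⌊ x /2⌋≡ A → ⌊ x ⊕ y /2⌋≡ C →
                      ι (- + 2) ⊕ y ≺ ι (+ 2 * (C - A)) × ι (+ 2 * (C - A)) ≺ ι (+ 2) ⊕ y
  ⌊/2⌋-+-difference {x} {y} {A} {C} hA hC =
    ≺-by-difference (≼-≺-trans (⊕-mono-≼ (lower hA) ≼-refl) (upper hC)) (⊹-cong (re-lower (re y) A C) refl) ,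
    ≺-by-difference (≼-≺-trans (lower hC) (⊕-mono-≺-≼ (upper hA) ≼-refl)) (⊹-cong (re-upper (re y) A C) refl)
    where
    re-lower : ∀ u A C → + 2 * (C - A) - (- + 2 + u) ≡ (+ 2 * C + + 2) - (+ 2 * A + u)
    re-lower = solve-∀
    re-upper : ∀ u A C → (+ 2 + u) - + 2 * (C - A) ≡ (+ 2 * A + + 2 + u) - + 2 * C
    re-upper = solve-∀

  -- For x = 2t with ⌊t⌋ = B: {t} ≥ 1 - c (that is, ⌊t + c⌋ = B + 1) and {t} ≤ 1/2.
  Window : ℤ√2 → ℤ → Set
  Window x B = ι (+ 2 * B + + 2) ≼ x ⊕ √2· 1ℤ × x ≼ ι (+ 2 * B + 1ℤ)

  module _ {x : ℤ√2} {B A : ℤ} (hB : ⌊ x /2⌋≡ B) (hA : ⌊ x ⊕ √2· 1ℤ /2⌋≡ A) where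

    private
      2[B+1]≡2B+2 : ∀ B → + 2 * (B + 1ℤ) ≡ + 2 * B + + 2
      2[B+1]≡2B+2 B = *-distribˡ-+ (+ 2) B 1ℤ

    flat⊎jump : A ≡ B ⊎ A ≡ B + 1ℤ
    flat⊎jump = ⌊/2⌋-+-jump hB 0≺√2 √2≺2 hA

    window⇒jump : Window x B → A ≡ B + 1ℤ
    window⇒jump (2B+2≼x+√2 , _) with flat⊎jump
    ... | inj₂ A≡B+1 = A≡B+1
    ... | inj₁ refl =
      ⊥-elim (<⇒≱ (i<i+1 B) (⌊/2⌋-≥ hA (subst (λ k → ι k ≼ _) (sym (2[B+1]≡2B+2 B)) 2B+2≼x+√2)))

    flat⇒below-half : A ≡ B → x ≼ ι (+ 2 * B + 1ℤ)
    flat⇒below-half refl = ≺⇒≼ (≺-by-difference (≺-trans (⊕-monoʳ-≺ x 1≺√2) (upper hA))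
      (⊹-cong (re-cancel (re x) B) (im-cancel (im x))))
      where
      re-cancel : ∀ u B → (+ 2 * B + 1ℤ) - u ≡ (+ 2 * B + + 2) - (u + 1ℤ)
      re-cancel = solve-∀
      im-cancel : ∀ v → 0ℤ - v ≡ 0ℤ - (v + 0ℤ)
      im-cancel = solve-∀

    jump∧¬window⇒above-half : A ≡ B + 1ℤ → ¬ Window x B → ι (+ 2 * B + 1ℤ) ≺ x
    jump∧¬window⇒above-half refl ¬window with ≺-≽-dec (ι (+ 2 * B + 1ℤ)) x
    ... | inj₁ above = above
    ... | inj₂ below = ⊥-elim (¬window (subst (λ k → ι k ≼ _) (2[B+1]≡2B+2 B) (lower hA) , below))

    window⇒flat : Window x B → ⌊ x ⊕ √2· (+ 2) /2⌋≡ A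
    window⇒flat window@(2B+2≼x+√2 , x≼2B+1) with window⇒jump window
    ... | refl = record
      { lower = begin
          ι (+ 2 * (B + 1ℤ))          ≡⟨ cong ι (2[B+1]≡2B+2 B) ⟩
          ι (+ 2 * B + + 2)           ≤⟨ 2B+2≼x+√2 ⟩
          x ⊕ √2· 1ℤ                  <⟨ ⊕-monoʳ-≺ x (√2⊛-mono-≺ (ι-mono-< 1<2)) ⟩
          x ⊕ √2· (+ 2)                 ∎
      ; upper = begin-strict
          x ⊕ √2· (+ 2)                 ≤⟨ ⊕-mono-≼ x≼2B+1 ≼-refl ⟩
          ι (+ 2 * B + 1ℤ) ⊕ √2· (+ 2)  <⟨ ⊕-monoʳ-≺ (ι (+ 2 * B + 1ℤ)) 2√2≺3 ⟩
          ι (+ 2 * B + 1ℤ + + 3)      ≡⟨ cong ι (regroup B) ⟩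
          ι (+ 2 * (B + 1ℤ) + + 2)    ∎
      }
      where
      open ≼-Reasoning
      regroup : ∀ B → + 2 * B + 1ℤ + + 3 ≡ + 2 * (B + 1ℤ) + + 2
      regroup = solve-∀

    -- When y / 2 - P is just above (below) 1/2, E - (B + P) = ⌊x / 2 - B + y / 2 - P⌋ tells whether
    -- x / 2 - B exceeds 1/2, which makes A - E + P a lower (upper) bound for the indicator of the Window.
    module _ {y : ℤ√2} {P E : ℤ} (hE : ⌊ x ⊕ y /2⌋≡ E) where

      private
        t : ℤ
        t = E - (B + P)

        via-t : ∀ J → A ≡ B + J → A - E + P ≡ J - t
        via-t J refl = regroup B J E P
          where
          regroup : ∀ B J E P → B + J - E + P ≡ J - (E - (B + P))
          regroup = solve-∀

        via-t₀ : A ≡ B → A - E + P ≡ 0ℤ - t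
        via-t₀ refl = regroup B E P
          where
          regroup : ∀ B E P → B - E + P ≡ 0ℤ - (E - (B + P))
          regroup = solve-∀

        J-t≤J-c : ∀ J {c} → c ≤ t → J - t ≤ J - c
        J-t≤J-c J c≤t = +-monoʳ-≤ J (neg-mono-≤ c≤t)

        J-c≤J-t : ∀ J {c} → t ≤ c → J - c ≤ J - t
        J-c≤J-t J t≤c = +-monoʳ-≤ J (neg-mono-≤ t≤c)

      indicator-≥ : ∀ {i} → (i ≡ 1 × Window x B) ⊎ (i ≡ 0 × ¬ Window x B) →
                    ι (+ 2 * P + 1ℤ) ≺ y → A - E + P ≤ + i
      indicator-≥ (inj₁ (refl , window)) 2P+1≺y = begin
        A - E + P       ≡⟨ via-t 1ℤ (window⇒jump window) ⟩
        1ℤ - t          ≤⟨ J-t≤J-c 1ℤ (⌊/2⌋-+-≥ {A = B} {P = P} hB 2P+1≺y hE) ⟩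
        1ℤ              ∎
        where open ≤-Reasoning
      indicator-≥ (inj₂ (refl , ¬window)) 2P+1≺y with flat⊎jump
      ... | inj₁ A≡B = begin
        A - E + P       ≡⟨ via-t₀ A≡B ⟩
        0ℤ - t          ≤⟨ J-t≤J-c 0ℤ (⌊/2⌋-+-≥ {A = B} {P = P} hB 2P+1≺y hE) ⟩
        0ℤ              ∎
        where open ≤-Reasoning
      ... | inj₂ A≡B+1 = begin
        A - E + P       ≡⟨ via-t 1ℤ A≡B+1 ⟩
        1ℤ - t          ≤⟨ J-t≤J-c 1ℤ (⌊/2⌋-+-≥-above-half {A = B} {P = P} 2B+1≺x 2P+1≺y hE) ⟩
        0ℤ              ∎
        where
        open ≤-Reasoning
        2B+1≺x : ι (+ 2 * B + 1ℤ) ≺ x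
        2B+1≺x = jump∧¬window⇒above-half A≡B+1 ¬window

      indicator-≤ : ∀ {i} → (i ≡ 1 × Window x B) ⊎ (i ≡ 0 × ¬ Window x B) →
                    y ≺ ι (+ 2 * P + 1ℤ) → + i ≤ A - E + P
      indicator-≤ (inj₁ (refl , window@(_ , x≼2B+1))) y≺2P+1 = begin
        1ℤ              ≤⟨ J-c≤J-t 1ℤ (⌊/2⌋-+-≤-below-half {A = B} {P = P} x≼2B+1 y≺2P+1 hE) ⟩
        1ℤ - t          ≡⟨ via-t 1ℤ (window⇒jump window) ⟨
        A - E + P       ∎
        where open ≤-Reasoning
      indicator-≤ (inj₂ (refl , ¬window)) y≺2P+1 with flat⊎jump
      ... | inj₁ A≡B = begin
        0ℤ              ≤⟨ J-c≤J-t 0ℤ (⌊/2⌋-+-≤-below-half {A = B} {P = P} x≼2B+1 y≺2P+1 hE) ⟩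
        0ℤ - t          ≡⟨ via-t₀ A≡B ⟨
        A - E + P       ∎
        where
        open ≤-Reasoning
        x≼2B+1 : x ≼ ι (+ 2 * B + 1ℤ)
        x≼2B+1 = flat⇒below-half A≡B
      ... | inj₂ A≡B+1 = begin
        0ℤ              ≤⟨ J-c≤J-t 1ℤ (⌊/2⌋-+-≤ {A = B} {P = P} hB y≺2P+1 hE) ⟩
        1ℤ - t          ≡⟨ via-t 1ℤ A≡B+1 ⟨
        A - E + P       ∎
        where open ≤-Reasoning

  -- Multiplication by √2 sends √2· k to the integer 2k, turning the Window into a floor equation.
  module _ {k B A : ℤ} (hB : ⌊ √2· k /2⌋≡ B) (hA : ⌊ √2· k ⊕ √2· 1ℤ /2⌋≡ A) where

    window⇒⌊√2·[A+B]/2⌋≡k : Window (√2· k) B → ⌊ √2· (A + B) /2⌋≡ k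
    window⇒⌊√2·[A+B]/2⌋≡k window@(2B+2≼x+√2 , x≼2B+1) with window⇒jump hB hA window
    ... | refl = record
      { lower = begin
          ι (+ 2 * k)                ≤⟨ √2⊛-mono-≼ x≼2B+1 ⟩
          √2· (+ 2 * B + 1ℤ)         ≡⟨ cong √2·_ (regroup B) ⟩
          √2· (B + 1ℤ + B)           ∎
      ; upper = begin-strict
          √2· (B + 1ℤ + B)           ≡⟨ cong √2·_ (regroup B) ⟨
          √2· (+ 2 * B + 1ℤ)         <⟨ √2⊛-mono-≺ (ι-mono-< (+-monoʳ-< (+ 2 * B) 1<2)) ⟩
          √2· (+ 2 * B + + 2)        ≤⟨ √2⊛-mono-≼ 2B+2≼x+√2 ⟩
          ι (+ 2 * (k + 1ℤ))         ≡⟨ cong ι (*-distribˡ-+ (+ 2) k 1ℤ) ⟩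
          ι (+ 2 * k + + 2)          ∎
      }
      where
      open ≼-Reasoning
      regroup : ∀ B → + 2 * B + 1ℤ ≡ B + 1ℤ + B
      regroup = solve-∀

    ⌊√2·[A+B]/2⌋≡k⇒window : k ≢ 0ℤ → ⌊ √2· (A + B) /2⌋≡ k → Window (√2· k) B
    ⌊√2·[A+B]/2⌋≡k⇒window k≢0 hk with flat⊎jump hB hA
    ... | inj₁ refl = ⊥-elim (≼⇒⊁ x≼2A (ι≼√2·⇒ι≺√2· (lower hB) k≢0))
      where
      2*B≡B+B : ∀ B → + 2 * B ≡ B + B
      2*B≡B+B = solve-∀
      x≼2A : √2· k ≼ ι (+ 2 * A)
      x≼2A = subst (λ c → √2· k ≼ ι c) (sym (2*B≡B+B A)) (√2⊛-cancel-≼ (lower hk))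
    ... | inj₂ refl =
      subst (λ c → ι c ≼ _) (*-distribˡ-+ (+ 2) B 1ℤ) (lower hA) ,
      subst (λ c → √2· k ≼ ι c) (regroup B) (√2⊛-cancel-≼ (lower hk))
      where
      regroup : ∀ B → B + 1ℤ + B ≡ + 2 * B + 1ℤ
      regroup = solve-∀

module DensityEstimates where

  open import Data.Nat as ℕ using (ℕ; suc)
  open import Data.Integer hiding (suc; Positive; positive; _⊖_)
  open import Data.Integer.Properties
  open import Relation.Binary.PropositionalEquality
  open import Data.Integer.Tactic.RingSolver using (solve-∀)
  open ℤ[√2]

  module _ (P : ℤ) (q N′ : ℕ) where

    slope : ℤ√2
    slope = ι (+ 2 * P * + N′) ⊕ √2· (+ N′ - + q * + N′)

    -- Each estimate adds up scaled copies of its hypotheses (and of √2 < 2 or 0 < √2); re-sum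
    -- and im-sum check that the two sides of this sum differ exactly as the two sides of the goal.
    count-large-enough : ∀ k {C D} → D ≤ C →
      ι (- (+ 2 * (+ q + 1ℤ))) ⊕ slope ≺ ι (+ 2 * D) →
      √2· (+ suc k * + q) ≺ ι (+ suc k * (+ 2 * P + 1ℤ) + 1ℤ) →
      + suc k * (+ 2 * + q + + 3) ≤ + N′ →
      √2· (+ suc N′ * + suc k) ≺ ι (+ 2 * C * + suc k + + suc N′ * + suc k + + 2 * + suc N′)
    count-large-enough k {C} {D} D≤C slope-below-2D Kq√2≺ K[2q+3]≤N′ = ≺-by-difference
      (⊕-mono-≺-≼ (⊕-mono-≺-≼ (⊕-mono-≺-≼ (⊕-mono-≺-≼
        (·-mono-≺ k slope-below-2C)
        (·-mono-≼ N′ (≺⇒≼ Kq√2≺)))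
        (≺⇒≼ (·-mono-≺ k √2≺2)))
        (ι-mono-≤ K[2q+3]≤N′))
        (≺⇒≼ 0≺2))
      (⊹-cong (re-sum C P (+ q) (+ N′) (+ suc k)) (im-sum (+ q) (+ N′) (+ suc k)))
      where
      slope-below-2C : ι (- (+ 2 * (+ q + 1ℤ))) ⊕ slope ≺ ι (+ 2 * C)
      slope-below-2C = ≺-≼-trans slope-below-2D (ι-mono-≤ (*-monoˡ-≤-nonNeg (+ 2) D≤C))
      re-sum : ∀ C P q N K →
        (+ 2 * C * K + (1ℤ + N) * K + + 2 * (1ℤ + N)) - 0ℤ ≡
        (K * (+ 2 * C) + N * (K * (+ 2 * P + 1ℤ) + 1ℤ) + K * + 2 + N + + 2) -
        (K * (- (+ 2 * (q + 1ℤ)) + (+ 2 * P * N + 0ℤ)) + N * 0ℤ + K * 0ℤ + K * (+ 2 * q + + 3) + 0ℤ)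
      re-sum = solve-∀
      im-sum : ∀ q N K →
        0ℤ - (1ℤ + N) * K ≡
        (K * 0ℤ + N * 0ℤ + K * 0ℤ + 0ℤ + 0ℤ) -
        (K * (0ℤ + (0ℤ + (N - q * N))) + N * (K * q) + K * 1ℤ + 0ℤ + 0ℤ)
      im-sum = solve-∀

    count-small-enough : ∀ k {C D} → C ≤ D + 1ℤ →
      ι (+ 2 * D) ≺ ι (+ 2 * (+ q + 1ℤ)) ⊕ slope →
      ι (+ suc k * (+ 2 * P + 1ℤ)) ≺ √2· (+ suc k * + q) ⊕ ι 1ℤ →
      + suc k * (+ 2 * + q + + 5) ≤ + N′ →
      ι (+ 2 * C * + suc k + + suc N′ * + suc k - + 2 * + suc N′) ≺ √2· (+ suc N′ * + suc k)
    count-small-enough k {C} {D} C≤D+1 2D-below-slope K[2P+1]≺ K[2q+5]≤N′ = ≺-by-difference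
      (⊕-mono-≺-≼ (⊕-mono-≺-≼ (⊕-mono-≺-≼
        (·-mono-≺ k 2C-below-slope)
        (·-mono-≼ N′ (≺⇒≼ K[2P+1]≺)))
        (ι-mono-≤ K[2q+5]≤N′))
        (≺⇒≼ (⊕-mono-≺ 0≺2 0≺√2·K)))
      (⊹-cong (re-sum C P (+ q) (+ N′) (+ suc k)) (im-sum (+ q) (+ N′) (+ suc k)))
      where
      0≺√2·K : ι 0ℤ ≺ √2· (+ suc k)
      0≺√2·K = ι≺√2·-by-squares (ℕ.s≤s ℕ.z≤n)
      2C-below-slope : ι (+ 2 * C) ≺ ι (+ 2 * (+ q + 1ℤ)) ⊕ slope ⊕ ι (+ 2)
      2C-below-slope = begin-strict
        ι (+ 2 * C)                               ≤⟨ ι-mono-≤ (*-monoˡ-≤-nonNeg (+ 2) C≤D+1) ⟩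
        ι (+ 2 * (D + 1ℤ))                        ≡⟨ cong ι (*-distribˡ-+ (+ 2) D 1ℤ) ⟩
        ι (+ 2 * D) ⊕ ι (+ 2)                     <⟨ ⊕-monoˡ-≺ (ι (+ 2)) 2D-below-slope ⟩
        ι (+ 2 * (+ q + 1ℤ)) ⊕ slope ⊕ ι (+ 2)    ∎
        where open ≼-Reasoning
      re-sum : ∀ C P q N K →
        0ℤ - (+ 2 * C * K + (1ℤ + N) * K - + 2 * (1ℤ + N)) ≡
        (K * (+ 2 * (q + 1ℤ) + (+ 2 * P * N + 0ℤ) + + 2) + N * (0ℤ + 1ℤ) + N + (+ 2 + 0ℤ)) -
        (K * (+ 2 * C) + N * (K * (+ 2 * P + 1ℤ)) + K * (+ 2 * q + + 5) + (0ℤ + 0ℤ))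
      re-sum = solve-∀
      im-sum : ∀ q N K →
        (1ℤ + N) * K - 0ℤ ≡
        (K * (0ℤ + (0ℤ + (N - q * N)) + 0ℤ) + N * (K * q + 0ℤ) + 0ℤ + (0ℤ + K)) -
        (K * 0ℤ + N * 0ℤ + 0ℤ + (0ℤ + 0ℤ))
      im-sum = solve-∀

module PellSolutions where

  open import Data.Nat
  open import Data.Nat.Properties
  open import Relation.Binary.PropositionalEquality
  open import Data.Nat.Tactic.RingSolver using (solve-∀)

  record OddPair : Set where
    constructor ⟨_,_⟩
    field
      P q : ℕ
  open OddPair public

  odd : OddPair → ℕ
  odd p = suc (2 * P p)

  NegativePell PositivePell : OddPair → Set
  NegativePell p = suc (odd p * odd p) ≡ 2 * (q p * q p)
  PositivePell p = odd p * odd p ≡ suc (2 * (q p * q p))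

  -- (x + y√2)(1 + √2) = (x + 2y) + (x + y)√2 flips the sign of x² - 2y² and keeps x odd.
  next : OddPair → OddPair
  next ⟨ P , q ⟩ = ⟨ P + q , suc (2 * P) + q ⟩

  private
    norm-flip : ∀ P q → suc (2 * (P + q)) * suc (2 * (P + q)) + suc (2 * P) * suc (2 * P)
                      ≡ 2 * ((suc (2 * P) + q) * (suc (2 * P) + q)) + 2 * (q * q)
    norm-flip = solve-∀

  next-negative : ∀ p → NegativePell p → PositivePell (next p)
  next-negative ⟨ P , q ⟩ e = +-cancelʳ-≡ (odd ⟨ P , q ⟩ * odd ⟨ P , q ⟩) _ _ (begin
    x′ * x′ + x * x              ≡⟨ norm-flip P q ⟩
    2 * (y′ * y′) + 2 * (q * q)  ≡⟨ cong (2 * (y′ * y′) +_) e ⟨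
    2 * (y′ * y′) + suc (x * x)  ≡⟨ +-suc (2 * (y′ * y′)) (x * x) ⟩
    suc (2 * (y′ * y′)) + x * x  ∎)
    where
    open ≡-Reasoning
    x x′ y′ : ℕ
    x = odd ⟨ P , q ⟩
    x′ = odd (next ⟨ P , q ⟩)
    y′ = OddPair.q (next ⟨ P , q ⟩)

  next-positive : ∀ p → PositivePell p → NegativePell (next p)
  next-positive ⟨ P , q ⟩ e = +-cancelʳ-≡ (2 * (q * q)) _ _ (begin
    suc (x′ * x′) + 2 * (q * q)  ≡⟨ +-suc (x′ * x′) (2 * (q * q)) ⟨
    x′ * x′ + suc (2 * (q * q))  ≡⟨ cong (x′ * x′ +_) e ⟨
    x′ * x′ + x * x              ≡⟨ norm-flip P q ⟩
    2 * (y′ * y′) + 2 * (q * q)  ∎)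
    where
    open ≡-Reasoning
    x x′ y′ : ℕ
    x = odd ⟨ P , q ⟩
    x′ = odd (next ⟨ P , q ⟩)
    y′ = OddPair.q (next ⟨ P , q ⟩)

  negativePell : ℕ → OddPair
  negativePell zero = ⟨ 0 , 1 ⟩
  negativePell (suc i) = next (next (negativePell i))

  positivePell : ℕ → OddPair
  positivePell i = next (negativePell i)

  negativePell-solves : ∀ i → NegativePell (negativePell i)
  negativePell-solves zero = refl
  negativePell-solves (suc i) =
    next-positive (next (negativePell i)) (next-negative (negativePell i) (negativePell-solves i))

  positivePell-solves : ∀ i → PositivePell (positivePell i)
  positivePell-solves i = next-negative (negativePell i) (negativePell-solves i)

  P-next-next : ∀ p → suc (P p) ≤ P (next (next p))
  P-next-next ⟨ P , q ⟩ = ≤-trans (s≤s (m≤m+n P q)) (m<m+n (P + q) (s≤s z≤n))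

  negativePell-P-≥ : ∀ i → i ≤ P (negativePell i)
  negativePell-P-≥ zero = z≤n
  negativePell-P-≥ (suc i) = ≤-trans (s≤s (negativePell-P-≥ i)) (P-next-next (negativePell i))

  positivePell-P-≥ : ∀ i → i ≤ P (positivePell i)
  positivePell-P-≥ i = ≤-trans (negativePell-P-≥ i) (m≤m+n _ _)

  negativePell-close : ∀ K p → NegativePell p → K ≤ odd p →
                       2 * ((K * q p) * (K * q p)) < suc (K * odd p) * suc (K * odd p)
  negativePell-close K p e K≤x = begin-strict
    2 * ((K * y) * (K * y))            ≡⟨ scale K y ⟩
    (K * K) * (2 * (y * y))            ≡⟨ cong ((K * K) *_) e ⟨
    (K * K) * suc (x * x)              ≡⟨ expand K x ⟩
    (K * x) * (K * x) + K * K          <⟨ +-monoʳ-< ((K * x) * (K * x)) K²<2Kx+1 ⟩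
    (K * x) * (K * x) + suc (2 * (K * x))  ≡⟨ square-suc (K * x) ⟨
    suc (K * x) * suc (K * x)          ∎
    where
    open ≤-Reasoning
    x y : ℕ
    x = odd p
    y = q p
    K²<2Kx+1 : K * K < suc (2 * (K * x))
    K²<2Kx+1 = s≤s (≤-trans (*-monoʳ-≤ K K≤x) (m≤m+n (K * x) (K * x + 0)))
    scale : ∀ K y → 2 * ((K * y) * (K * y)) ≡ (K * K) * (2 * (y * y))
    scale = solve-∀
    expand : ∀ K x → (K * K) * suc (x * x) ≡ (K * x) * (K * x) + K * K
    expand = solve-∀
    square-suc : ∀ z → suc z * suc z ≡ z * z + suc (2 * z)
    square-suc = solve-∀

  positivePell-close : ∀ k p → PositivePell p → suc k < odd p →
                       (2 * P p + k * odd p) * (2 * P p + k * odd p) < 2 * ((suc k * q p) * (suc k * q p))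
  positivePell-close k p e K<x = +-cancelʳ-< (K * K) (W * W) (2 * ((K * y) * (K * y))) (begin-strict
    W * W + K * K                      <⟨ +-monoʳ-< (W * W) K²<2W+1 ⟩
    W * W + suc (2 * W)                ≡⟨ square-suc W ⟨
    suc W * suc W                      ≡⟨ cong (λ z → z * z) (suc-W k (P p)) ⟩
    (K * x) * (K * x)                  ≡⟨ square-* K x ⟩
    (K * K) * (x * x)                  ≡⟨ cong ((K * K) *_) e ⟩
    (K * K) * suc (2 * (y * y))        ≡⟨ expand K y ⟩
    2 * ((K * y) * (K * y)) + K * K    ∎)
    where
    open ≤-Reasoning
    K x y W : ℕ
    K = suc k
    x = odd p
    y = q p
    W = 2 * P p + k * x
    suc-W : ∀ k P → suc (2 * P + k * suc (2 * P)) ≡ suc k * suc (2 * P)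
    suc-W = solve-∀
    square-suc : ∀ z → suc z * suc z ≡ z * z + suc (2 * z)
    square-suc = solve-∀
    square-* : ∀ K x → (K * x) * (K * x) ≡ (K * K) * (x * x)
    square-* = solve-∀
    expand : ∀ K y → (K * K) * suc (2 * (y * y)) ≡ 2 * ((K * y) * (K * y)) + K * K
    expand = solve-∀
    K*K≤W : K * K ≤ W
    K*K≤W = ≤-trans (m≤m+n (K * K) k) (s≤s⁻¹ (begin
      suc (K * K + k)                  ≡⟨ +-suc (K * K) k ⟨
      K * K + K                        ≡⟨ +-comm (K * K) K ⟩
      K + K * K                        ≡⟨ *-suc K K ⟨
      K * suc K                        ≤⟨ *-monoʳ-≤ K K<x ⟩
      K * x                            ≡⟨ suc-W k (P p) ⟨
      suc W                            ∎))
    K²<2W+1 : K * K < suc (2 * W)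
    K²<2W+1 = s≤s (≤-trans K*K≤W (m≤m+n W (W + 0)))

module PellApproximations where

  open import Data.Nat as ℕ using (ℕ; suc; s≤s)
  import Data.Nat.Properties as ℕ
  open import Data.Integer hiding (suc; Positive; positive; _⊖_)
  open import Data.Integer.Properties
  open import Relation.Binary.PropositionalEquality
  open ℤ[√2]
  open PellSolutions
  import Data.Nat.Tactic.RingSolver

  private
    +odd : ∀ P → + suc (2 ℕ.* P) ≡ + 2 * + P + 1ℤ
    +odd P = trans (cong +_ (ℕ.+-comm 1 (2 ℕ.* P))) (cong (_+ 1ℤ) (pos-* 2 P))

    P≤odd : ∀ p → P p ℕ.≤ odd p
    P≤odd p = ℕ.m≤n⇒m≤1+n (ℕ.m≤m+n (P p) (P p ℕ.+ 0))

  negativePell-below : ∀ p → NegativePell p → ι (+ 2 * + P p + 1ℤ) ≺ √2· (+ q p)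
  negativePell-below p e =
    subst (λ u → ι u ≺ √2· (+ q p)) (+odd (P p)) (ι≺√2·-by-squares (ℕ.≤-reflexive e))

  negativePell-close-above : ∀ k p → NegativePell p → suc k ℕ.≤ P p →
    √2· (+ suc k * + q p) ≺ ι (+ suc k * (+ 2 * + P p + 1ℤ) + 1ℤ)
  negativePell-close-above k p e K≤P =
    subst₂ (λ v u → √2· v ≺ ι u) (pos-* (suc k) (q p))
      (trans (cong +_ (ℕ.+-comm 1 (suc k ℕ.* odd p)))
             (cong (_+ 1ℤ) (trans (pos-* (suc k) (odd p)) (cong (+ suc k *_) (+odd (P p))))))
      (√2·≺ι-by-squares (negativePell-close (suc k) p e (ℕ.≤-trans K≤P (P≤odd p))))

  positivePell-above : ∀ p → PositivePell p → √2· (+ q p) ≺ ι (+ 2 * + P p + 1ℤ)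
  positivePell-above p e =
    subst (λ u → √2· (+ q p) ≺ ι u) (+odd (P p)) (√2·≺ι-by-squares (ℕ.≤-reflexive (sym e)))

  positivePell-close-below : ∀ k p → PositivePell p → suc k ℕ.≤ P p →
    ι (+ suc k * (+ 2 * + P p + 1ℤ)) ≺ √2· (+ suc k * + q p) ⊕ ι 1ℤ
  positivePell-close-below k p e K≤P =
    subst₂ (λ u v → ι u ≺ √2· v ⊕ ι 1ℤ)
      (trans (cong +_ (W+1≡Kx k (P p))) (trans (pos-* (suc k) (odd p)) (cong (+ suc k *_) (+odd (P p)))))
      (pos-* (suc k) (q p))
      (⊕-monoˡ-≺ (ι 1ℤ) (ι≺√2·-by-squares (positivePell-close k p e (s≤s (ℕ.≤-trans K≤P P≤2P)))))
    where
    P≤2P : P p ℕ.≤ 2 ℕ.* P p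
    P≤2P = ℕ.m≤m+n (P p) (P p ℕ.+ 0)
    W+1≡Kx : ∀ k P → 2 ℕ.* P ℕ.+ k ℕ.* suc (2 ℕ.* P) ℕ.+ 1 ≡ suc k ℕ.* suc (2 ℕ.* P)
    W+1≡Kx = Data.Nat.Tactic.RingSolver.solve-∀

module FloorSequence (a : ℤ → ℤ) (a-floor : IsFloorCnD a) where

  open import Data.Nat as ℕ using (ℕ; zero; suc)
  import Data.Nat.Properties as ℕ
  open import Data.Integer hiding (suc; Positive; positive; _⊖_)
  open import Data.Integer.Properties
  open import Algebra.Properties.AbelianGroup +-0-abelianGroup using (∙-cancelʳ)
  open import Data.Product using (_×_; _,_; proj₁; proj₂; ∃)
  open import Data.Sum using (_⊎_; inj₁; inj₂)
  open import Data.Bool using (if_then_else_)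
  open import Relation.Nullary using (¬_; yes; no)
  open import Relation.Nullary.Decidable using (⌊_⌋)
  open import Relation.Binary.PropositionalEquality
  open import Data.Integer.Tactic.RingSolver using (solve-∀)
  open ℤ[√2]
  open HalfFloors
  open DensityEstimates
  open PellSolutions using (OddPair; P; q; negativePell; positivePell;
                            negativePell-solves; positivePell-solves; negativePell-P-≥; positivePell-P-≥)
  open PellApproximations

  -- ξ n = 2 (c n + d + 2) with c = 1/√2 and d = 2 (√2 - 1).
  ξ : ℤ → ℤ√2
  ξ n = √2· (n + + 4)

  ξ-+ : ∀ n k → ξ (n + k) ≡ ξ n ⊕ √2· k
  ξ-+ n k = cong √2·_ (regroup n k)
    where
    regroup : ∀ n k → n + k + + 4 ≡ n + + 4 + k
    regroup = solve-∀

  private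
    2[A+3]≡2[A+2]+2 : ∀ A → + 2 * (A + + 3) ≡ + 2 * (A + + 2) + + 2
    2[A+3]≡2[A+2]+2 = solve-∀
    m+5≡m+1+4 : ∀ m → m + + 5 ≡ m + 1ℤ + + 4
    m+5≡m+1+4 = solve-∀
    2A+5≡2[A+2]+1 : ∀ A → + 2 * A + + 5 ≡ + 2 * (A + + 2) + 1ℤ
    2A+5≡2[A+2]+1 = solve-∀

  ⌊ξ/2⌋≡a+2 : ∀ n → ⌊ ξ n /2⌋≡ a n + + 2
  ⌊ξ/2⌋≡a+2 n = record
    { lower = ≤√2*⇒ι≼√2· (proj₁ (a-floor n))
    ; upper = subst (λ c → ξ n ≺ ι c) (2[A+3]≡2[A+2]+2 (a n)) (√2*<⇒√2·≺ι (proj₂ (a-floor n)))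
    }

  a-unique : ∀ {m c} → ⌊ ξ m /2⌋≡ c + + 2 → a m ≡ c
  a-unique {m} {c} h = ∙-cancelʳ (+ 2) (a m) c (⌊/2⌋-unique (⌊ξ/2⌋≡a+2 m) h)

  θ∈⇒window : ∀ m → θ∈[1-c,1/2] a m → Window (ξ m) (a m + + 2)
  θ∈⇒window m (θ≥1-c , θ≤½) =
    subst₂ _≼_ (cong ι (2[A+3]≡2[A+2]+2 (a m))) (ξ-+ m 1ℤ)
      (≤√2*⇒ι≼√2· (subst ((+ 2 * (a m + + 3)) ≤√2*_) (m+5≡m+1+4 m) θ≥1-c)) ,
    subst (ξ m ≼_) (cong ι (2A+5≡2[A+2]+1 (a m))) (√2*≤⇒√2·≼ι θ≤½)

  window⇒θ∈ : ∀ m → Window (ξ m) (a m + + 2) → θ∈[1-c,1/2] a m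
  window⇒θ∈ m (θ≥1-c , θ≤½) =
    subst ((+ 2 * (a m + + 3)) ≤√2*_) (sym (m+5≡m+1+4 m))
      (ι≼√2·⇒≤√2* (subst₂ _≼_ (cong ι (sym (2[A+3]≡2[A+2]+2 (a m)))) (sym (ξ-+ m 1ℤ)) θ≥1-c)) ,
    √2·≼ι⇒√2*≤ (subst (ξ m ≼_) (cong ι (sym (2A+5≡2[A+2]+1 (a m)))) θ≤½)

  𝟙𝒟 : ℤ → ℕ
  𝟙𝒟 n = if ⌊ δ a n ≟ + 1 ⌋ then 1 else 0

  module AtStep (n : ℤ) (n+3≢0 : n - 1ℤ + + 4 ≢ 0ℤ) where

    private
      m : ℤ
      m = n - 1ℤ

    ⌊ξ[n-1]/2⌋ : ⌊ ξ m /2⌋≡ a m + + 2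
    ⌊ξ[n-1]/2⌋ = ⌊ξ/2⌋≡a+2 m

    ⌊ξ[n-1]+√2/2⌋ : ⌊ ξ m ⊕ √2· 1ℤ /2⌋≡ a n + + 2
    ⌊ξ[n-1]+√2/2⌋ = subst (⌊_/2⌋≡ a n + + 2) (trans (cong ξ (regroup n)) (ξ-+ m 1ℤ)) (⌊ξ/2⌋≡a+2 n)
      where
      regroup : ∀ n → n ≡ n - 1ℤ + 1ℤ
      regroup = solve-∀

    private
      ⌊ξ[f[n]]/2⌋ : ⌊ √2· ((a n + + 2) + (a m + + 2)) /2⌋≡ a (f a n) + + 2
      ⌊ξ[f[n]]/2⌋ = subst (⌊_/2⌋≡ a (f a n) + + 2) (cong √2·_ (regroup (a n) (a m))) (⌊ξ/2⌋≡a+2 (f a n))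
        where
        regroup : ∀ A B → A + B + + 4 ≡ (A + + 2) + (B + + 2)
        regroup = solve-∀

      +2-[m+4]≡-n-1 : ∀ x → x + + 2 - (n - 1ℤ + + 4) ≡ x - n - 1ℤ
      +2-[m+4]≡-n-1 x = regroup x n
        where
        regroup : ∀ x n → x + + 2 - (n - 1ℤ + + 4) ≡ x - n - 1ℤ
        regroup = solve-∀

      δ≡1⇒a[f[n]]+2≡m+4 : δ a n ≡ 1ℤ → a (f a n) + + 2 ≡ m + + 4
      δ≡1⇒a[f[n]]+2≡m+4 δ≡1 = i-j≡0⇒i≡j _ _ (trans (+2-[m+4]≡-n-1 (a (f a n))) (cong (_- 1ℤ) δ≡1))

      a[f[n]]+2≡m+4⇒δ≡1 : a (f a n) + + 2 ≡ m + + 4 → δ a n ≡ 1ℤ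
      a[f[n]]+2≡m+4⇒δ≡1 e = i-j≡0⇒i≡j _ _ (begin
        a (f a n) - n - 1ℤ                   ≡⟨ +2-[m+4]≡-n-1 (a (f a n)) ⟨
        a (f a n) + + 2 - (m + + 4)          ≡⟨ cong (_- (m + + 4)) e ⟩
        m + + 4 - (m + + 4)                  ≡⟨ +-inverseʳ (m + + 4) ⟩
        0ℤ                                   ∎)
        where open ≡-Reasoning

    δ≡1⇒window : δ a n ≡ 1ℤ → Window (ξ m) (a m + + 2)
    δ≡1⇒window δ≡1 = ⌊√2·[A+B]/2⌋≡k⇒window ⌊ξ[n-1]/2⌋ ⌊ξ[n-1]+√2/2⌋ n+3≢0
      (subst (⌊ √2· ((a n + + 2) + (a m + + 2)) /2⌋≡_) (δ≡1⇒a[f[n]]+2≡m+4 δ≡1) ⌊ξ[f[n]]/2⌋)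

    window⇒δ≡1 : Window (ξ m) (a m + + 2) → δ a n ≡ 1ℤ
    window⇒δ≡1 window = a[f[n]]+2≡m+4⇒δ≡1
      (⌊/2⌋-unique ⌊ξ[f[n]]/2⌋ (window⇒⌊√2·[A+B]/2⌋≡k ⌊ξ[n-1]/2⌋ ⌊ξ[n-1]+√2/2⌋ window))

    window⇒a[n+1]≡a[n] : Window (ξ m) (a m + + 2) → a (n + 1ℤ) ≡ a n
    window⇒a[n+1]≡a[n] window = a-unique
      (subst (⌊_/2⌋≡ a n + + 2) (sym (trans (cong ξ (regroup n)) (ξ-+ m (+ 2))))
             (window⇒flat ⌊ξ[n-1]/2⌋ ⌊ξ[n-1]+√2/2⌋ window))
      where
      regroup : ∀ n → n + 1ℤ ≡ n - 1ℤ + + 2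
      regroup = solve-∀

    𝟙𝒟-indicates-window : (𝟙𝒟 n ≡ 1 × Window (ξ m) (a m + + 2))
                        ⊎ (𝟙𝒟 n ≡ 0 × ¬ Window (ξ m) (a m + + 2))
    𝟙𝒟-indicates-window with δ a n ≟ + 1
    ... | yes δ≡1 = inj₁ (refl , δ≡1⇒window δ≡1)
    ... | no δ≢1 = inj₂ (refl , λ window → δ≢1 (window⇒δ≡1 window))

    module _ (q : ℕ) (P : ℤ) where

      private
        ⌊ξ[n-1]+√2q/2⌋ : ⌊ ξ m ⊕ √2· (+ q) /2⌋≡ a (m + + q) + + 2
        ⌊ξ[n-1]+√2q/2⌋ = subst (⌊_/2⌋≡ a (m + + q) + + 2) (ξ-+ m (+ q)) (⌊ξ/2⌋≡a+2 (m + + q))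

        cancel-2 : ∀ A E → A + + 2 - (E + + 2) + P ≡ A - E + P
        cancel-2 A E = regroup A E P
          where
          regroup : ∀ A E P → A + + 2 - (E + + 2) + P ≡ A - E + P
          regroup = solve-∀

      𝟙𝒟-lower : ι (+ 2 * P + 1ℤ) ≺ √2· (+ q) → a n - a (m + + q) + P ≤ + 𝟙𝒟 n
      𝟙𝒟-lower 2P+1≺√2q = subst (_≤ + 𝟙𝒟 n) (cancel-2 (a n) (a (m + + q)))
        (indicator-≥ ⌊ξ[n-1]/2⌋ ⌊ξ[n-1]+√2/2⌋ ⌊ξ[n-1]+√2q/2⌋ 𝟙𝒟-indicates-window 2P+1≺√2q)

      𝟙𝒟-upper : √2· (+ q) ≺ ι (+ 2 * P + 1ℤ) → + 𝟙𝒟 n ≤ a n - a (m + + q) + P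
      𝟙𝒟-upper √2q≺2P+1 = subst (+ 𝟙𝒟 n ≤_) (cancel-2 (a n) (a (m + + q)))
        (indicator-≤ ⌊ξ[n-1]/2⌋ ⌊ξ[n-1]+√2/2⌋ ⌊ξ[n-1]+√2q/2⌋ 𝟙𝒟-indicates-window √2q≺2P+1)

  Σa : ℕ → ℤ → ℤ
  Σa zero x = 0ℤ
  Σa (suc q) x = Σa q x + a (x + + q)

  Σa-telescope : ∀ q x → Σa q (x + 1ℤ) - Σa q x ≡ a (x + + q) - a x
  Σa-telescope zero x = begin
    0ℤ                   ≡⟨ +-inverseʳ (a x) ⟨
    a x - a x            ≡⟨ cong (λ y → a y - a x) (+-identityʳ x) ⟨
    a (x + + 0) - a x    ∎
    where open ≡-Reasoning
  Σa-telescope (suc q) x = begin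
    Σa q (x + 1ℤ) + a (x + 1ℤ + + q) - (Σa q x + a (x + + q))
      ≡⟨ regroup (Σa q (x + 1ℤ)) (Σa q x) (a (x + 1ℤ + + q)) (a (x + + q)) ⟩
    (Σa q (x + 1ℤ) - Σa q x) + (a (x + 1ℤ + + q) - a (x + + q))
      ≡⟨ cong (_+ (a (x + 1ℤ + + q) - a (x + + q))) (Σa-telescope q x) ⟩
    (a (x + + q) - a x) + (a (x + 1ℤ + + q) - a (x + + q))
      ≡⟨ +-comm (a (x + + q) - a x) _ ⟩
    (a (x + 1ℤ + + q) - a (x + + q)) + (a (x + + q) - a x)
      ≡⟨ +-minus-telescope (a (x + 1ℤ + + q)) (a (x + + q)) (a x) ⟩
    a (x + 1ℤ + + q) - a x
      ≡⟨ cong (λ y → a y - a x) (+-assoc x 1ℤ (+ q)) ⟩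
    a (x + + suc q) - a x
      ∎
    where
    open ≡-Reasoning
    regroup : ∀ s t u v → s + u - (t + v) ≡ (s - t) + (u - v)
    regroup = solve-∀

  countD-≥-telescoping : (Ψ : ℤ → ℤ) →
    (∀ N → Ψ (+ suc (suc N)) - Ψ (+ suc N) ≤ + 𝟙𝒟 (+ suc (suc N))) →
    ∀ N → Ψ (+ suc N) - Ψ 1ℤ ≤ + countD a (suc N)
  countD-≥-telescoping Ψ step zero = ≤-trans (≤-reflexive (+-inverseʳ (Ψ 1ℤ))) (+≤+ ℕ.z≤n)
  countD-≥-telescoping Ψ step (suc N) = begin
    Ψ₂ - Ψ₀                   ≡⟨ +-minus-telescope Ψ₂ Ψ₁ Ψ₀ ⟨
    (Ψ₂ - Ψ₁) + (Ψ₁ - Ψ₀)     ≤⟨ +-mono-≤ (step N) (countD-≥-telescoping Ψ step N) ⟩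
    + i + + c                 ≡⟨ +-comm (+ i) (+ c) ⟩
    + (c ℕ.+ i)               ∎
    where
    open ≤-Reasoning
    Ψ₂ Ψ₁ Ψ₀ : ℤ
    Ψ₂ = Ψ (+ suc (suc N))
    Ψ₁ = Ψ (+ suc N)
    Ψ₀ = Ψ 1ℤ
    i c : ℕ
    i = 𝟙𝒟 (+ suc (suc N))
    c = countD a (suc N)

  countD-≤-telescoping : (Ψ : ℤ → ℤ) →
    (∀ N → + 𝟙𝒟 (+ suc (suc N)) ≤ Ψ (+ suc (suc N)) - Ψ (+ suc N)) →
    ∀ N → + countD a (suc N) ≤ Ψ (+ suc N) - Ψ 1ℤ + 1ℤ
  countD-≤-telescoping Ψ step zero =
    ≤-trans (+≤+ (𝟙𝒟≤1 (+ 1))) (≤-reflexive (cong (_+ 1ℤ) (sym (+-inverseʳ (Ψ 1ℤ)))))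
    where
    𝟙𝒟≤1 : ∀ n → 𝟙𝒟 n ℕ.≤ 1
    𝟙𝒟≤1 n with δ a n ≟ + 1
    ... | yes _ = ℕ.s≤s ℕ.z≤n
    ... | no _ = ℕ.z≤n
  countD-≤-telescoping Ψ step (suc N) = begin
    + (c ℕ.+ i)                      ≡⟨ +-comm (+ c) (+ i) ⟩
    + i + + c                        ≤⟨ +-mono-≤ (step N) (countD-≤-telescoping Ψ step N) ⟩
    (Ψ₂ - Ψ₁) + (Ψ₁ - Ψ₀ + 1ℤ)       ≡⟨ +-assoc (Ψ₂ - Ψ₁) (Ψ₁ - Ψ₀) 1ℤ ⟨
    (Ψ₂ - Ψ₁) + (Ψ₁ - Ψ₀) + 1ℤ       ≡⟨ cong (_+ 1ℤ) (+-minus-telescope Ψ₂ Ψ₁ Ψ₀) ⟩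
    Ψ₂ - Ψ₀ + 1ℤ                     ∎
    where
    open ≤-Reasoning
    Ψ₂ Ψ₁ Ψ₀ : ℤ
    Ψ₂ = Ψ (+ suc (suc N))
    Ψ₁ = Ψ (+ suc N)
    Ψ₀ = Ψ 1ℤ
    i c : ℕ
    i = 𝟙𝒟 (+ suc (suc N))
    c = countD a (suc N)

  a-growth : ∀ x K → ι (- + 2) ⊕ √2· K ≺ ι (+ 2 * (a (x + K) - a x))
                   × ι (+ 2 * (a (x + K) - a x)) ≺ ι (+ 2) ⊕ √2· K
  a-growth x K = subst (λ d → ι (- + 2) ⊕ √2· K ≺ ι (+ 2 * d) × ι (+ 2 * d) ≺ ι (+ 2) ⊕ √2· K)
    (cancel (a (x + K)) (a x))
    (⌊/2⌋-+-difference {y = √2· K} (⌊ξ/2⌋≡a+2 x)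
      (subst (⌊_/2⌋≡ a (x + K) + + 2) (ξ-+ x K) (⌊ξ/2⌋≡a+2 (x + K))))
    where
    cancel : ∀ C A → (C + + 2) - (A + + 2) ≡ C - A
    cancel = solve-∀

  Σa-growth : ∀ q x K → q · (ι (- + 2) ⊕ √2· K) ≼ ι (+ 2 * (Σa q (x + K) - Σa q x))
                      × ι (+ 2 * (Σa q (x + K) - Σa q x)) ≼ q · (ι (+ 2) ⊕ √2· K)
  Σa-growth zero x K = inj₂ refl , inj₂ refl
  Σa-growth (suc q) x K = (begin
      suc q · (ι (- + 2) ⊕ √2· K)                      ≡⟨ ·-suc q (ι (- + 2) ⊕ √2· K) ⟩
      (ι (- + 2) ⊕ √2· K) ⊕ q · (ι (- + 2) ⊕ √2· K)
        ≤⟨ ⊕-mono-≼ (≺⇒≼ (proj₁ (a-growth (x + + q) K))) (proj₁ (Σa-growth q x K)) ⟩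
      ι (+ 2 * d) ⊕ ι (+ 2 * ΔΣ)                       ≡⟨ split ⟨
      ι (+ 2 * (Σa (suc q) (x + K) - Σa (suc q) x))    ∎) ,
    (begin
      ι (+ 2 * (Σa (suc q) (x + K) - Σa (suc q) x))    ≡⟨ split ⟩
      ι (+ 2 * d) ⊕ ι (+ 2 * ΔΣ)
        ≤⟨ ⊕-mono-≼ (≺⇒≼ (proj₂ (a-growth (x + + q) K))) (proj₂ (Σa-growth q x K)) ⟩
      (ι (+ 2) ⊕ √2· K) ⊕ q · (ι (+ 2) ⊕ √2· K)        ≡⟨ ·-suc q (ι (+ 2) ⊕ √2· K) ⟨
      suc q · (ι (+ 2) ⊕ √2· K)                        ∎)
    where
    open ≼-Reasoning
    d ΔΣ : ℤ
    d = a (x + + q + K) - a (x + + q)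
    ΔΣ = Σa q (x + K) - Σa q x
    split : ι (+ 2 * (Σa (suc q) (x + K) - Σa (suc q) x)) ≡ ι (+ 2 * d) ⊕ ι (+ 2 * ΔΣ)
    split = cong ι (trans (cong (λ y → + 2 * (Σa q (x + K) + a y - Σa (suc q) x)) (swap x K (+ q)))
                          (regroup (Σa q (x + K)) (Σa q x) (a (x + + q + K)) (a (x + + q))))
      where
      swap : ∀ x K q → x + K + q ≡ x + q + K
      swap = solve-∀
      regroup : ∀ S′ S u v → + 2 * (S′ + u - (S + v)) ≡ + 2 * (u - v) + + 2 * (S′ - S)
      regroup = solve-∀

  module Potential (q : ℕ) (P : ℤ) where

    Φ : ℤ → ℤ
    Φ x = a x - Σa q x + P * x

    Φ-step : ∀ n → Φ n - Φ (n - 1ℤ) ≡ a n - a (n - 1ℤ + + q) + P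
    Φ-step n = begin
      Φ n - Φ m                                                 ≡⟨ regroup₁ (a n) (a m) (Σa q n) (Σa q m) P n m ⟩
      (a n - a m) - (Σa q n - Σa q m) + P * (n - m)
        ≡⟨ cong₂ (λ s d → (a n - a m) - s + P * d) Σa-step n-m≡1 ⟩
      (a n - a m) - (a (m + + q) - a m) + P * 1ℤ               ≡⟨ regroup₂ (a n) (a m) (a (m + + q)) P ⟩
      a n - a (m + + q) + P                                    ∎
      where
      open ≡-Reasoning
      m : ℤ
      m = n - 1ℤ
      n≡m+1 : ∀ n → n ≡ n - 1ℤ + 1ℤ
      n≡m+1 = solve-∀
      n-m≡1 : n - m ≡ 1ℤ
      n-m≡1 = identity n
        where
        identity : ∀ n → n - (n - 1ℤ) ≡ 1ℤ
        identity = solve-∀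
      Σa-step : Σa q n - Σa q m ≡ a (m + + q) - a m
      Σa-step = trans (cong (λ y → Σa q y - Σa q m) (n≡m+1 n)) (Σa-telescope q m)
      regroup₁ : ∀ A B S T P n m → (A - S + P * n) - (B - T + P * m) ≡ (A - B) - (S - T) + P * (n - m)
      regroup₁ = solve-∀
      regroup₂ : ∀ A B E P → (A - B) - (E - B) + P * 1ℤ ≡ A - E + P
      regroup₂ = solve-∀

    countD-≥-Φ : ι (+ 2 * P + 1ℤ) ≺ √2· (+ q) → ∀ N → Φ (+ suc N) - Φ 1ℤ ≤ + countD a (suc N)
    countD-≥-Φ 2P+1≺√2q = countD-≥-telescoping Φ λ N →
      subst (_≤ + 𝟙𝒟 (+ suc (suc N))) (sym (Φ-step (+ suc (suc N))))
        (AtStep.𝟙𝒟-lower (+ suc (suc N)) (λ ()) q P 2P+1≺√2q)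

    countD-≤-Φ : √2· (+ q) ≺ ι (+ 2 * P + 1ℤ) → ∀ N → + countD a (suc N) ≤ Φ (+ suc N) - Φ 1ℤ + 1ℤ
    countD-≤-Φ √2q≺2P+1 = countD-≤-telescoping Φ λ N →
      subst (+ 𝟙𝒟 (+ suc (suc N)) ≤_) (sym (Φ-step (+ suc (suc N))))
        (AtStep.𝟙𝒟-upper (+ suc (suc N)) (λ ()) q P √2q≺2P+1)

    module _ (N′ : ℕ) where

      private
        α σ D : ℤ
        α = a (+ suc N′) - a 1ℤ
        σ = Σa q (+ suc N′) - Σa q 1ℤ
        D = Φ (+ suc N′) - Φ 1ℤ

      slope-below-2ΔΦ : ι (- (+ 2 * (+ q + 1ℤ))) ⊕ slope P q N′ ≺ ι (+ 2 * D)
      slope-below-2ΔΦ = ≺-by-difference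
        (⊕-mono-≺-≼ (proj₁ (a-growth 1ℤ (+ N′))) (proj₂ (Σa-growth q 1ℤ (+ N′))))
        (⊹-cong (re-sum (a (+ suc N′)) (a 1ℤ) (Σa q (+ suc N′)) (Σa q 1ℤ) P (+ q) (+ N′))
                (im-sum (+ q) (+ N′)))
        where
        re-sum : ∀ aN a1 ΣN Σ1 P q N →
          + 2 * ((aN - ΣN + P * (1ℤ + N)) - (a1 - Σ1 + P * 1ℤ)) - (- (+ 2 * (q + 1ℤ)) + (+ 2 * P * N + 0ℤ)) ≡
          (+ 2 * (aN - a1) + q * (+ 2 + 0ℤ)) - ((- + 2 + 0ℤ) + + 2 * (ΣN - Σ1))
        re-sum = solve-∀
        im-sum : ∀ q N → 0ℤ - (0ℤ + (0ℤ + (N - q * N))) ≡ (0ℤ + q * (0ℤ + N)) - ((0ℤ + N) + 0ℤ)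
        im-sum = solve-∀

      2ΔΦ-below-slope : ι (+ 2 * D) ≺ ι (+ 2 * (+ q + 1ℤ)) ⊕ slope P q N′
      2ΔΦ-below-slope = ≺-by-difference
        (⊕-mono-≺-≼ (proj₂ (a-growth 1ℤ (+ N′))) (proj₁ (Σa-growth q 1ℤ (+ N′))))
        (⊹-cong (re-sum (a (+ suc N′)) (a 1ℤ) (Σa q (+ suc N′)) (Σa q 1ℤ) P (+ q) (+ N′))
                (im-sum (+ q) (+ N′)))
        where
        re-sum : ∀ aN a1 ΣN Σ1 P q N →
          (+ 2 * (q + 1ℤ) + (+ 2 * P * N + 0ℤ)) - + 2 * ((aN - ΣN + P * (1ℤ + N)) - (a1 - Σ1 + P * 1ℤ)) ≡
          ((+ 2 + 0ℤ) + + 2 * (ΣN - Σ1)) - (+ 2 * (aN - a1) + q * (- + 2 + 0ℤ))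
        re-sum = solve-∀
        im-sum : ∀ q N → (0ℤ + (0ℤ + (N - q * N))) - 0ℤ ≡ ((0ℤ + N) + 0ℤ) - (0ℤ + q * (0ℤ + N))
        im-sum = solve-∀

  δ≡1⇔θ∈[1-c,1/2] : (n : ℤ) → + 2 ≤ n →
                    (δ a n ≡ + 1 → θ∈[1-c,1/2] a (n - + 1)) × (θ∈[1-c,1/2] a (n - + 1) → δ a n ≡ + 1)
  δ≡1⇔θ∈[1-c,1/2] n@(+ suc (suc _)) _ =
    (λ δ≡1 → window⇒θ∈ (n - 1ℤ) (δ≡1⇒window δ≡1)) ,
    (λ θ∈ → window⇒δ≡1 (θ∈⇒window (n - 1ℤ) θ∈))
    where open AtStep n (λ ())
  δ≡1⇔θ∈[1-c,1/2] +0 (+≤+ ())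
  δ≡1⇔θ∈[1-c,1/2] +[1+ zero ] (+≤+ (ℕ.s≤s ()))

  δ≡1⇒a[n+1]≡a[n] : (n : ℤ) → + 1 ≤ n → δ a n ≡ + 1 → a (n + + 1) ≡ a n
  δ≡1⇒a[n+1]≡a[n] n@(+ suc j) _ δ≡1 = window⇒a[n+1]≡a[n] (δ≡1⇒window δ≡1)
    where open AtStep n (λ e → ℕ.1+n≢0 (trans (ℕ.+-comm 4 j) (+-injective e)))
  δ≡1⇒a[n+1]≡a[n] +0 (+≤+ ()) _

  density : ∀ k → ∃ λ N₀ → ∀ N → N₀ ℕ.≤ N → DensityClose a (suc k) N
  density k = suc (N₁ ℕ.+ N₂) , close
    where
    K : ℕ
    K = suc k
    p₁ p₂ : OddPair
    p₁ = negativePell K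
    p₂ = positivePell K
    N₁ N₂ : ℕ
    N₁ = K ℕ.* (2 ℕ.* q p₁ ℕ.+ 3)
    N₂ = K ℕ.* (2 ℕ.* q p₂ ℕ.+ 5)
    cast-≤ : ∀ c y {N′} → K ℕ.* (2 ℕ.* y ℕ.+ c) ℕ.≤ N′ → + K * (+ 2 * + y + + c) ≤ + N′
    cast-≤ c y le = subst (_≤ _) (trans (pos-* K _) (cong (λ z → + K * (z + + c)) (pos-* 2 y))) (+≤+ le)
    close : ∀ N → suc (N₁ ℕ.+ N₂) ℕ.≤ N → DensityClose a K N
    close (suc N′) (ℕ.s≤s N₁+N₂≤N′) =
      ι≺√2·⇒<√2* (count-small-enough (+ P p₂) (q p₂) N′ k
        (Potential.countD-≤-Φ (q p₂) (+ P p₂) (positivePell-above p₂ (positivePell-solves K)) N′)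
        (Potential.2ΔΦ-below-slope (q p₂) (+ P p₂) N′)
        (positivePell-close-below k p₂ (positivePell-solves K) (positivePell-P-≥ K))
        (cast-≤ 5 (q p₂) (ℕ.≤-trans (ℕ.m≤n+m N₂ N₁) N₁+N₂≤N′))) ,
      √2·≺ι⇒√2*< (count-large-enough (+ P p₁) (q p₁) N′ k
        (Potential.countD-≥-Φ (q p₁) (+ P p₁) (negativePell-below p₁ (negativePell-solves K)) N′)
        (Potential.slope-below-2ΔΦ (q p₁) (+ P p₁) N′)
        (negativePell-close-above k p₁ (negativePell-solves K) (negativePell-P-≥ K))
        (cast-≤ 3 (q p₁) (ℕ.≤-trans (ℕ.m≤m+n N₁ N₂) N₁+N₂≤N′)))

open import Data.Nat as ℕ using (ℕ; suc)
open import Data.Integer using (+_; _+_; _-_; _≤_)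
open import Data.Product using (_×_; ∃; _,_)
open import Relation.Binary.PropositionalEquality using (_≡_)

theorem6p1 : (a : ℤ → ℤ) → IsFloorCnD a →
    ((n : ℤ) → + 2 ≤ n →
        ((δ a n ≡ + 1 → θ∈[1-c,1/2] a (n - + 1))
         × (θ∈[1-c,1/2] a (n - + 1) → δ a n ≡ + 1)))
    × ((n : ℤ) → + 1 ≤ n → δ a n ≡ + 1 → a (n + + 1) ≡ a n)
    × ((k : ℕ) → ∃ λ N₀ → (N : ℕ) → N₀ ℕ.≤ N → DensityClose a (suc k) N)
theorem6p1 a a-floor = δ≡1⇔θ∈[1-c,1/2] , δ≡1⇒a[n+1]≡a[n] , density
  where open FloorSequence a a-floor
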